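{- For every pattern $A$ and every $A$-respecting $S\subseteq V_k$, $\Phi(A)\ge\Phi(A\upharpoonright S)+c(A\upharpoonright\bar S)$.
   Context: $V_k=\{v_0,\dots,v_k\}$, $E_k=\{v_iv_{i+1}:0\le i<k\}$, $\bar S=V_k\setminus S$. A pattern is the empty pattern $\emptyset$ or a rooted unordered binary tree (internal nodes with two children) with leaves labeled by elements of $E_k$; $G_A=(V_A,E_A)$ with $E_A$ the set of labels and $V_A$ their endpoints; $c(A)$ = number of connected components of $G_A$; atomic = one leaf; $\{A,B\}$ = pattern whose root has subtrees $A,B$; sub-patterns $A'\preceq A$ are subtrees of nodes. $S\subseteq V_k$ is $A$-respecting if every leaf label of $A$ has both endpoints in $S$ or both in $\bar S$. For $A$-respecting $S$, $A\upharpoonright S$ is obtained from $A$ by deleting leaves labeled by edges with both endpoints in $\bar S$, removing internal nodes with no remaining leaves below, and splicing out internal nodes with a single remaining child (so $\{A,B\}\upharpoonright S=\{A\upharpoonright S,B\upharpoonright S\}$, with $\{X,\emptyset\}=X$). For patterns $A,B$, $A\ominus B=A\upharpoonright S$ where $S$ is the union of the vertex sets of components of $G_A$ disjoint from $V_B$. $\Phi$ is the unique minimal real function on patterns such that $\Phi(\emptyset)=0$, $\Phi(A)=2$ for atomic $A$, and for every non-atomic $C=\{A,B\}$ and all $A'\preceq A$, $B'\preceq B$: ($\dagger$) $\Phi(C)\ge\Phi(A')+c(B\ominus A')+c(C\ominus\{A',B\})$ and ($\ddagger$) $\Phi(C)\ge\frac12\big(\Phi(A')+\Phi(B'\ominus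 A')+c(C)+c(C\ominus\{A',B'\})\big)$, together with the same inequalities with the roles of $A$ and $B$ (and $A'$, $B'$) exchanged.
   Formalization: Φ takes values in ℚ rather than ℝ, and is minimal among the rational-valued functions satisfying its defining conditions. -}

module Defs where

open import Data.Nat as ℕ using (ℕ; zero; suc; _⊓_; _⊔_; _∸_; _≡ᵇ_)
open import Data.Fin using (Fin; toℕ; inject₁) renaming (suc to fsuc)
open import Data.Fin.Subset using (Subset; _∈_; _∉_; ∁)
open import Data.Vec using (lookup; tabulate)
open import Data.Bool using (Bool; true; false; _∧_; _∨_; not; if_then_else_)
open import Data.List using (List; []; _∷_; _++_)
open import Data.Bool.ListAction using (any)
open import Data.List.Relation.Unary.All using (All)
open import Data.Product using (_×_)
open import Data.Sum using (_⊎_)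
open import Data.Integer using (+_)
open import Data.Rational using (ℚ; _/_; _≤_; _+_; _*_; ½; 0ℚ)
open import Relation.Binary.PropositionalEquality using (_≡_)

-- Vertices of the path P_k: v_0..v_k, i.e. Fin (suc k).
-- Edges: edge i (i : Fin k) is v_i v_{i+1}, endpoints inject₁ i and fsuc i.

-- Non-empty rooted binary trees with leaves labelled by edges of E_k.
-- (Children are ordered in the representation; all constraints below are
-- imposed in both orders, as in the paper.)
data Tree (k : ℕ) : Set where
  leaf : Fin k → Tree k
  node : Tree k → Tree k → Tree k

data Pattern (k : ℕ) : Set where
  ∅    : Pattern k
  tree : Tree k → Pattern k

⟪_,_⟫ : ∀ {k} → Tree k → Tree k → Pattern k
⟪ A , B ⟫ = tree (node A B)

data _⪯_ {k : ℕ} : Tree k → Tree k → Set where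
  here  : ∀ {A} → A ⪯ A
  left  : ∀ {A' A B} → A' ⪯ A → A' ⪯ node A B
  right : ∀ {A' A B} → A' ⪯ B → A' ⪯ node A B

labelsT : ∀ {k} → Tree k → List (Fin k)
labelsT (leaf e)   = e ∷ []
labelsT (node A B) = labelsT A ++ labelsT B

labels : ∀ {k} → Pattern k → List (Fin k)
labels ∅        = []
labels (tree A) = labelsT A

inE : ∀ {k} → Pattern k → ℕ → Bool
inE A i = any (λ e → toℕ e ≡ᵇ i) (labels A)

inV : ∀ {k} → Pattern k → ℕ → Bool
inV A zero    = inE A zero
inV A (suc v) = inE A (suc v) ∨ inE A v

edgesIn : ∀ {k} → Pattern k → ℕ → ℕ → Bool
edgesIn A lo zero    = true
edgesIn A lo (suc n) = inE A lo ∧ edgesIn A (suc lo) n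

-- Since G_A is a
-- subgraph of the path P_k, the only u–w path in P_k uses exactly the
-- edges between min(u,w) and max(u,w); so u, w are connected in G_A iff
-- both are vertices of G_A and all those edges belong to E_A.
conn : ∀ {k} → Pattern k → ℕ → ℕ → Bool
conn A u w = inV A u ∧ inV A w ∧ edgesIn A (u ⊓ w) ((u ⊔ w) ∸ (u ⊓ w))

anyBelow : ℕ → (ℕ → Bool) → Bool
anyBelow zero    p = false
anyBelow (suc n) p = p n ∨ anyBelow n p

countBelow : ℕ → (ℕ → Bool) → ℕ
countBelow zero    p = zero
countBelow (suc n) p = (if p n then 1 else 0) ℕ.+ countBelow n p

-- c(A): number of connected components of G_A, counted via their least
-- vertex (a vertex of G_A connected to no smaller vertex).
c : ∀ {k} → Pattern k → ℕ
c {k} A = countBelow (suc k) (λ v → inV A v ∧ not (anyBelow v (λ w → conn A w v)))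

Respecting : ∀ {k} → Pattern k → Subset (suc k) → Set
Respecting A S =
  All (λ e → (inject₁ e ∈ S × fsuc e ∈ S) ⊎ (inject₁ e ∉ S × fsuc e ∉ S)) (labels A)

pair : ∀ {k} → Pattern k → Pattern k → Pattern k
pair ∅        Y        = Y
pair (tree X) ∅        = tree X
pair (tree X) (tree Y) = tree (node X Y)

-- A ↾ S : delete leaves whose label does not have its endpoints in S
-- (for A-respecting S these are exactly the leaves with both endpoints in
-- S̄), prune empty subtrees, splice out unary nodes.
restrictT : ∀ {k} → Tree k → Subset (suc k) → Pattern k
restrictT (leaf e) S =
  if lookup S (inject₁ e) ∧ lookup S (fsuc e) then tree (leaf e) else ∅
restrictT (node A B) S = pair (restrictT A S) (restrictT B S)

_↾_ : ∀ {k} → Pattern k → Subset (suc k) → Pattern k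
∅      ↾ S = ∅
tree A ↾ S = restrictT A S

-- A ⊖ B = A ↾ S, S = union of vertex sets of components of G_A disjoint from V_B.
_⊖_ : ∀ {k} → Pattern k → Pattern k → Pattern k
_⊖_ {k} A B = A ↾ tabulate (λ v →
  inV A (toℕ v) ∧ not (anyBelow (suc k) (λ w → conn A (toℕ v) w ∧ inV B w)))

ℕ→ℚ : ℕ → ℚ
ℕ→ℚ n = (+ n) / 1

cℚ : ∀ {k} → Pattern k → ℚ
cℚ A = ℕ→ℚ (c A)

2ℚ : ℚ
2ℚ = (+ 2) / 1

Admissible : ∀ {k} → (Pattern k → ℚ) → Set
Admissible {k} f =
  (f ∅ ≡ 0ℚ)
  × (∀ (e : Fin k) → f (tree (leaf e)) ≡ 2ℚ)
  × (∀ (A B A' B' : Tree k) → A' ⪯ A → B' ⪯ B →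
       let C = ⟪ A , B ⟫ in
       -- (†)
       (f (tree A') + cℚ (tree B ⊖ tree A') + cℚ (C ⊖ ⟪ A' , B ⟫) ≤ f C)
       -- (‡)
     × (½ * (f (tree A') + f (tree B' ⊖ tree A') + cℚ C + cℚ (C ⊖ ⟪ A' , B' ⟫)) ≤ f C)
       -- (†) with A and B exchanged
     × (f (tree B') + cℚ (tree A ⊖ tree B') + cℚ (C ⊖ ⟪ B' , A ⟫) ≤ f C)
       -- (‡) with A and B exchanged
     × (½ * (f (tree B') + f (tree A' ⊖ tree B') + cℚ C + cℚ (C ⊖ ⟪ B' , A' ⟫)) ≤ f C))

IsΦ : ∀ {k} → (Pattern k → ℚ) → Set
IsΦ {k} Φ = Admissible Φ × (∀ (g : Pattern k → ℚ) → Admissible g → ∀ A → Φ A ≤ g A)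

module Submission where

-- Every graph G_A is a set of edges of the path P_k, so we work with edge sets
-- E : ℕ → Bool (edge i joins v_i and v_{i+1}) and vertex predicates s : ℕ → Bool;
-- c(A) is then the number of runs of consecutive edges of G_A.  Next, patterns
-- are related to edge sets: ↾ and ⊖ both keep the leaves satisfying a label
-- predicate, G_{P ⊖ Q} consists of the edges of P whose component avoids V_Q,
-- and restricting to a respected side commutes with ⊖ (⊖-restrict).
--
-- The theorem is proved by induction on the number of leaves (module
-- Induction).  Single edges and the case where one subtree of C = {A , B}
-- vanishes on S follow from (†) directly.  When C ↾ S = {TA , TB}, each defining
-- inequality of Φ at {TA , TB} holds with M = Φ(C) - c(C ↾ S̄) in place of
-- Φ({TA , TB}): it comes from the inequality at C for preimage sub-patterns and
-- the induction hypothesis.  Minimality of Φ then gives Φ({TA , TB}) ≤ M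
-- (module Lowering), which is the claim for C.

open import Defs
open import Data.Nat as ℕ using (ℕ; zero; suc; _⊓_; _⊔_; _∸_; _≡ᵇ_; z≤n; s≤s)
import Data.Nat.Properties as ℕP
open import Data.Bool using (Bool; true; false; _∧_; _∨_; not; if_then_else_; T)
import Data.Bool.Properties as BP
open import Data.Product using (Σ; _×_; _,_; proj₁; proj₂)
open import Data.Sum using (_⊎_; inj₁; inj₂)
open import Data.Empty using (⊥; ⊥-elim)
open import Data.Unit using (tt)
open import Data.Fin using (Fin; toℕ; inject₁) renaming (suc to fsuc; zero to fzero)
import Data.Fin.Properties as FP
open import Data.Fin.Subset using (Subset; ∁; _∈_; _∉_)
open import Data.Vec using (Vec; []; _∷_; lookup)
import Data.Vec.Properties as VP
open import Data.List using (List; []; _∷_; _++_)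
import Data.List.Properties as LP
open import Data.List.Relation.Unary.All using (All; []; _∷_)
open import Data.Bool.ListAction using (any)
open import Data.Rational as ℚ using (ℚ; _≤_; _+_; _*_; _-_; ½)
import Data.Rational.Properties as ℚP
open import Relation.Binary.PropositionalEquality
open import Relation.Binary.Definitions using (tri<; tri≈; tri>)
open import Relation.Nullary using (yes; no; ¬_; Dec)
open import Algebra.Bundles using (CommutativeMonoid)
open import Algebra.Properties.CommutativeSemigroup ℕP.+-commutativeSemigroup using (interchange)
import Algebra.Properties.CommutativeSemigroup as CommutativeSemigroupProperties
module ∨-Properties = CommutativeSemigroupProperties (CommutativeMonoid.commutativeSemigroup BP.∨-commutativeMonoid)

∧-elim : ∀ {a b} → a ∧ b ≡ true → a ≡ true × b ≡ true
∧-elim {true} {true} _ = refl , refl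

∧-intro : ∀ {a b} → a ≡ true → b ≡ true → a ∧ b ≡ true
∧-intro refl refl = refl

∨-elim : ∀ {a b} → a ∨ b ≡ true → a ≡ true ⊎ b ≡ true
∨-elim {true} _ = inj₁ refl
∨-elim {false} {true} _ = inj₂ refl

∨-introˡ : ∀ {a} b → a ≡ true → a ∨ b ≡ true
∨-introˡ b refl = refl

∨-introʳ : ∀ a {b} → b ≡ true → a ∨ b ≡ true
∨-introʳ true refl = refl
∨-introʳ false refl = refl

∨-false-elim : ∀ {a b} → a ∨ b ≡ false → a ≡ false × b ≡ false
∨-false-elim {false} {false} _ = refl , refl

∧-false-elim : ∀ {a b} → a ≡ true → a ∧ b ≡ false → b ≡ false
∧-false-elim refl h = h

∧-trueˡ : ∀ {a} b → a ≡ true → a ∧ b ≡ b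
∧-trueˡ b refl = refl

not-elim : ∀ {a} → not a ≡ true → a ≡ false
not-elim {false} _ = refl

not-intro : ∀ {a} → a ≡ false → not a ≡ true
not-intro refl = refl

true≢false : ∀ {a} → a ≡ true → a ≡ false → ⊥
true≢false refl ()

bool-cases : ∀ a → a ≡ false ⊎ a ≡ true
bool-cases false = inj₁ refl
bool-cases true = inj₂ refl

false-unless : ∀ {a} → ¬ (a ≡ true) → a ≡ false
false-unless {false} _ = refl
false-unless {true} h = ⊥-elim (h refl)

bool-ext : ∀ {a b} → (a ≡ true → b ≡ true) → (b ≡ true → a ≡ true) → a ≡ b
bool-ext {false} {false} f g = refl
bool-ext {false} {true} f g = g refl
bool-ext {true} {false} f g = sym (f refl)
bool-ext {true} {true} f g = refl

bit : Bool → ℕ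
bit b = if b then 1 else 0

sumBelow : ℕ → (ℕ → ℕ) → ℕ
sumBelow zero a = 0
sumBelow (suc n) a = a n ℕ.+ sumBelow n a

countBelow-sum : ∀ n p → countBelow n p ≡ sumBelow n (λ v → bit (p v))
countBelow-sum zero p = refl
countBelow-sum (suc n) p = cong (bit (p n) ℕ.+_) (countBelow-sum n p)

sumBelow-ext : ∀ n {a b : ℕ → ℕ} → (∀ v → a v ≡ b v) → sumBelow n a ≡ sumBelow n b
sumBelow-ext zero h = refl
sumBelow-ext (suc n) h = cong₂ ℕ._+_ (h n) (sumBelow-ext n h)

sumBelow-mono : ∀ n {a b : ℕ → ℕ} → (∀ v → a v ℕ.≤ b v) → sumBelow n a ℕ.≤ sumBelow n b
sumBelow-mono zero h = z≤n
sumBelow-mono (suc n) h = ℕP.+-mono-≤ (h n) (sumBelow-mono n h)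

sumBelow-+ : ∀ n (a b : ℕ → ℕ) → sumBelow n (λ v → a v ℕ.+ b v) ≡ sumBelow n a ℕ.+ sumBelow n b
sumBelow-+ zero a b = refl
sumBelow-+ (suc n) a b =
  trans (cong ((a n ℕ.+ b n) ℕ.+_) (sumBelow-+ n a b)) (interchange (a n) (b n) (sumBelow n a) (sumBelow n b))

anyBelow-none : ∀ n p → (∀ w → w ℕ.< n → p w ≡ false) → anyBelow n p ≡ false
anyBelow-none zero p h = refl
anyBelow-none (suc n) p h rewrite h n ℕP.≤-refl = anyBelow-none n p (λ w w<n → h w (ℕP.m≤n⇒m≤1+n w<n))

anyBelow-none⁻ : ∀ n p → anyBelow n p ≡ false → ∀ w → w ℕ.< n → p w ≡ false
anyBelow-none⁻ (suc n) p h w w<sn with ∨-false-elim {p n} h | ℕP.m≤n⇒m<n∨m≡n (ℕP.m<1+n⇒m≤n w<sn)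
... | _ , rest | inj₁ w<n = anyBelow-none⁻ n p rest w w<n
... | pn , _ | inj₂ refl = pn

anyBelow-witness : ∀ n p → anyBelow n p ≡ true → Σ ℕ λ w → w ℕ.< n × p w ≡ true
anyBelow-witness (suc n) p h with ∨-elim {p n} h
... | inj₁ pn = n , ℕP.≤-refl , pn
... | inj₂ r with anyBelow-witness n p r
... | w , w<n , pw = w , ℕP.m≤n⇒m≤1+n w<n , pw

anyBelow-intro : ∀ n p w → w ℕ.< n → p w ≡ true → anyBelow n p ≡ true
anyBelow-intro n p w w<n pw with bool-cases (anyBelow n p)
... | inj₂ t = t
... | inj₁ f = ⊥-elim (true≢false pw (anyBelow-none⁻ n p f w w<n))

EdgeSet : Set
EdgeSet = ℕ → Bool

vertex : EdgeSet → ℕ → Bool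
vertex E zero = E zero
vertex E (suc v) = E (suc v) ∨ E v

Joined : EdgeSet → ℕ → ℕ → Set
Joined E u w = ∀ x → u ⊓ w ℕ.≤ x → x ℕ.< u ⊔ w → E x ≡ true

_⊆ᴱ_ : EdgeSet → EdgeSet → Set
E ⊆ᴱ F = ∀ i → E i ≡ true → F i ≡ true

Respects : EdgeSet → (ℕ → Bool) → Set
Respects E s = ∀ i → E i ≡ true → s i ≡ s (suc i)

restrict : EdgeSet → (ℕ → Bool) → EdgeSet
restrict E p i = E i ∧ (p i ∧ p (suc i))

compl : (ℕ → Bool) → (ℕ → Bool)
compl s v = not (s v)

vertex-here : ∀ E v → E v ≡ true → vertex E v ≡ true
vertex-here E zero h = h
vertex-here E (suc v) h = ∨-introˡ (E v) h

vertex-next : ∀ E v → E v ≡ true → vertex E (suc v) ≡ true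
vertex-next E v h = ∨-introʳ (E (suc v)) h

vertex-ext : ∀ E F → (∀ i → E i ≡ F i) → ∀ v → vertex E v ≡ vertex F v
vertex-ext E F h zero = h zero
vertex-ext E F h (suc v) = cong₂ _∨_ (h (suc v)) (h v)

vertex-incident : ∀ E v → vertex E v ≡ true → Σ ℕ λ j → E j ≡ true × (j ≡ v ⊎ suc j ≡ v)
vertex-incident E zero h = zero , h , inj₁ refl
vertex-incident E (suc v) h with ∨-elim {E (suc v)} h
... | inj₁ x = suc v , x , inj₁ refl
... | inj₂ x = v , x , inj₂ refl

vertex-mono : ∀ E F → E ⊆ᴱ F → ∀ v → vertex E v ≡ true → vertex F v ≡ true
vertex-mono E F h v e with vertex-incident E v e
... | j , ej , inj₁ refl = vertex-here F j (h j ej)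
... | j , ej , inj₂ refl = vertex-next F j (h j ej)

vertex-∨ : ∀ E F v → vertex (λ i → E i ∨ F i) v ≡ vertex E v ∨ vertex F v
vertex-∨ E F zero = refl
vertex-∨ E F (suc v) = ∨-Properties.interchange (E (suc v)) (F (suc v)) (E v) (F v)

joined-refl : ∀ E u → Joined E u u
joined-refl E u x l h =
  ⊥-elim (ℕP.<-irrefl refl (ℕP.≤-<-trans (subst (ℕ._≤ x) (ℕP.⊓-idem u) l) (subst (x ℕ.<_) (ℕP.⊔-idem u) h)))

joined-sym : ∀ E u w → Joined E u w → Joined E w u
joined-sym E u w j x l h = j x (subst (ℕ._≤ x) (ℕP.⊓-comm w u) l) (subst (x ℕ.<_) (ℕP.⊔-comm w u) h)

joined-mono : ∀ E F → E ⊆ᴱ F → ∀ u w → Joined E u w → Joined F u w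
joined-mono E F s u w j x l h = s x (j x l h)

joined-edge : ∀ E i → E i ≡ true → Joined E i (suc i)
joined-edge E i e x l h rewrite ℕP.m≤n⇒m⊓n≡m (ℕP.n≤1+n i) | ℕP.m≤n⇒m⊔n≡n (ℕP.n≤1+n i)
  with ℕP.≤-antisym l (ℕP.m<1+n⇒m≤n h)
... | refl = e

joined-trans : ∀ E u v w → Joined E u v → Joined E v w → Joined E u w
joined-trans E u v w j₁ j₂ x l h with x ℕP.<? v
... | yes x<v with u ℕP.≤? x
...   | yes u≤x = j₁ x (ℕP.≤-trans (ℕP.m⊓n≤m u v) u≤x) (ℕP.<-≤-trans x<v (ℕP.m≤n⊔m u v))
...   | no u≰x = j₂ x (ℕP.≤-trans (ℕP.m⊓n≤n v w) w≤x) (ℕP.<-≤-trans x<v (ℕP.m≤m⊔n v w))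
  where
  w≤x : w ℕ.≤ x
  w≤x with ℕP.≤-total u w
  ... | inj₁ u≤w = ⊥-elim (u≰x (subst (ℕ._≤ x) (ℕP.m≤n⇒m⊓n≡m u≤w) l))
  ... | inj₂ w≤u = subst (ℕ._≤ x) (ℕP.m≥n⇒m⊓n≡n w≤u) l
joined-trans E u v w j₁ j₂ x l h | no x≮v with x ℕP.<? u
...   | yes x<u = j₁ x (ℕP.≤-trans (ℕP.m⊓n≤n u v) (ℕP.≮⇒≥ x≮v)) (ℕP.<-≤-trans x<u (ℕP.m≤m⊔n u v))
...   | no x≮u = j₂ x (ℕP.≤-trans (ℕP.m⊓n≤m v w) (ℕP.≮⇒≥ x≮v)) (ℕP.<-≤-trans x<w (ℕP.m≤n⊔m v w))
  where
  x<w : x ℕ.< w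
  x<w with ℕP.≤-total u w
  ... | inj₁ u≤w = subst (x ℕ.<_) (ℕP.m≤n⇒m⊔n≡n u≤w) h
  ... | inj₂ w≤u = ⊥-elim (x≮u (subst (x ℕ.<_) (ℕP.m≥n⇒m⊔n≡m w≤u) h))

joined-between : ∀ E u w x → u ⊓ w ℕ.≤ x → x ℕ.≤ u ⊔ w → Joined E u w → Joined E u x
joined-between E u w x l h j y l' h' =
  j y (ℕP.≤-trans (ℕP.⊓-glb (ℕP.m⊓n≤m u w) l) l') (ℕP.<-≤-trans h' (ℕP.⊔-lub (ℕP.m≤m⊔n u w) h))

joined-vertex : ∀ E i w → E i ≡ true → Joined E i w → vertex E w ≡ true
joined-vertex E i w e j with ℕP.<-cmp w i
... | tri≈ _ refl _ = vertex-here E w e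
... | tri< w<i _ _ =
  vertex-here E w (j w (ℕP.m⊓n≤n i w) (subst (w ℕ.<_) (sym (ℕP.m≥n⇒m⊔n≡m (ℕP.<⇒≤ w<i))) w<i))
... | tri> _ _ i<w with w
...   | suc w' = vertex-next E w' (j w' (subst (ℕ._≤ w') (sym (ℕP.m≤n⇒m⊓n≡m (ℕP.<⇒≤ i<w))) (ℕP.m<1+n⇒m≤n i<w))
                                       (subst (w' ℕ.<_) (sym (ℕP.m≤n⇒m⊔n≡n (ℕP.<⇒≤ i<w))) (ℕP.n<1+n w')))

vertex-joined : ∀ E v → vertex E v ≡ true → Σ ℕ λ j → E j ≡ true × Joined E v j
vertex-joined E v h with vertex-incident E v h
... | j , e , inj₁ refl = j , e , joined-refl E j
... | j , e , inj₂ refl = j , e , joined-sym E j (suc j) (joined-edge E j e)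

respects-run : ∀ E s → Respects E s → ∀ a n → (∀ x → a ℕ.≤ x → x ℕ.< a ℕ.+ n → E x ≡ true) → s a ≡ s (a ℕ.+ n)
respects-run E s r a zero p = cong s (sym (ℕP.+-identityʳ a))
respects-run E s r a (suc n) p = begin
  s a ≡⟨ respects-run E s r a n (λ x l h → p x l (ℕP.<-trans h step)) ⟩
  s (a ℕ.+ n) ≡⟨ r (a ℕ.+ n) (p (a ℕ.+ n) (ℕP.m≤m+n a n) step) ⟩
  s (suc (a ℕ.+ n)) ≡⟨ cong s end ⟩
  s (a ℕ.+ suc n) ∎
  where
  open ≡-Reasoning
  step : a ℕ.+ n ℕ.< a ℕ.+ suc n
  step = ℕP.+-monoʳ-< a (ℕP.n<1+n n)
  end : suc (a ℕ.+ n) ≡ a ℕ.+ suc n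
  end = sym (ℕP.+-suc a n)

respects-joined-≤ : ∀ E s → Respects E s → ∀ u w → u ℕ.≤ w → Joined E u w → s u ≡ s w
respects-joined-≤ E s r u w u≤w j = trans (respects-run E s r u (w ∸ u) run) (cong s (ℕP.m+[n∸m]≡n u≤w))
  where
  run : ∀ x → u ℕ.≤ x → x ℕ.< u ℕ.+ (w ∸ u) → E x ≡ true
  run x l h = j x (subst (ℕ._≤ x) (sym (ℕP.m≤n⇒m⊓n≡m u≤w)) l)
                  (subst (x ℕ.<_) (trans (ℕP.m+[n∸m]≡n u≤w) (sym (ℕP.m≤n⇒m⊔n≡n u≤w))) h)

respects-joined : ∀ E s → Respects E s → ∀ u w → Joined E u w → s u ≡ s w
respects-joined E s r u w j with ℕP.≤-total u w
... | inj₁ u≤w = respects-joined-≤ E s r u w u≤w j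
... | inj₂ w≤u = sym (respects-joined-≤ E s r w u w≤u (joined-sym E u w j))

respects-compl : ∀ E s → Respects E s → Respects E (compl s)
respects-compl E s r i e = cong not (r i e)

respects-⊆ : ∀ E F s → E ⊆ᴱ F → Respects F s → Respects E s
respects-⊆ E F s h r i e = r i (h i e)

restrict-⊆ : ∀ E p → restrict E p ⊆ᴱ E
restrict-⊆ E p i h = proj₁ (∧-elim {E i} h)

restrict-mono : ∀ E F p → E ⊆ᴱ F → restrict E p ⊆ᴱ restrict F p
restrict-mono E F p h i x with ∧-elim {E i} x
... | a , b = ∧-intro (h i a) b

joined-restrict : ∀ E p → Respects E p → ∀ u w → Joined E u w → p u ≡ true → Joined (restrict E p) u w
joined-restrict E p r u w j pu x l h =
  ∧-intro (j x l h) (∧-intro (side x l (ℕP.<⇒≤ h)) (side (suc x) (ℕP.m≤n⇒m≤1+n l) h))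
  where
  side : ∀ y → u ⊓ w ℕ.≤ y → y ℕ.≤ u ⊔ w → p y ≡ true
  side y lo hi = trans (sym (respects-joined E p r u y (joined-between E u w y lo hi j))) pu

vertex-restrict : ∀ E s → Respects E s → ∀ w → s w ≡ true → vertex E w ≡ true → vertex (restrict E s) w ≡ true
vertex-restrict E s r w sw v with vertex-incident E w v
... | j , e , inj₁ refl = vertex-here (restrict E s) j (∧-intro e (∧-intro sw (trans (sym (r j e)) sw)))
... | j , e , inj₂ refl = vertex-next (restrict E s) j (∧-intro e (∧-intro (trans (r j e) sw) sw))

-- Counting components.  On a path every component of an edge set is a run
-- of consecutive edges; it is counted once, at its first edge.

before : EdgeSet → ℕ → Bool
before E zero = false
before E (suc v) = E v

starts : EdgeSet → ℕ → Bool
starts E v = not (before E v) ∧ E v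

components : ℕ → EdgeSet → ℕ
components k E = sumBelow (suc k) (λ v → bit (starts E v))

components-ext : ∀ k E F → (∀ i → E i ≡ F i) → components k E ≡ components k F
components-ext k E F h = sumBelow-ext (suc k) (λ v → cong bit (starts-ext v))
  where
  starts-ext : ∀ v → starts E v ≡ starts F v
  starts-ext zero = cong (true ∧_) (h zero)
  starts-ext (suc v) = cong₂ (λ a b → not a ∧ b) (h v) (h (suc v))

-- Splitting along a respected predicate s: a run of E lies entirely on one
-- side, so the runs of the two restrictions are together at most those of E.
-- Pointwise this is a statement about the edge before and the edge at v.

split-start : ∀ e a b → bit (e ∧ (a ∧ b)) ℕ.+ bit (e ∧ (not a ∧ not b)) ℕ.≤ bit e
split-start false _ _ = z≤n
split-start true true true = s≤s z≤n
split-start true true false = z≤n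
split-start true false true = z≤n
split-start true false false = s≤s z≤n

split-point : ∀ e₀ e₁ a₀ a₁ a₂ → (e₀ ≡ true → a₀ ≡ a₁) →
              bit (not (e₀ ∧ (a₀ ∧ a₁)) ∧ (e₁ ∧ (a₁ ∧ a₂)))
                ℕ.+ bit (not (e₀ ∧ (not a₀ ∧ not a₁)) ∧ (e₁ ∧ (not a₁ ∧ not a₂)))
              ℕ.≤ bit (not e₀ ∧ e₁)
split-point false e₁ _ a₁ a₂ _ = split-start e₁ a₁ a₂
split-point true true true true _ _ = z≤n
split-point true false true true _ _ = z≤n
split-point true true false false _ _ = z≤n
split-point true false false false _ _ = z≤n
split-point true _ true false _ h = ⊥-elim (true≢false refl (h refl))
split-point true _ false true _ h = ⊥-elim (true≢false (h refl) refl)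

components-split : ∀ k E s → Respects E s →
                   components k (restrict E s) ℕ.+ components k (restrict E (compl s)) ℕ.≤ components k E
components-split k E s r = begin
  components k (restrict E s) ℕ.+ components k (restrict E (compl s))
    ≡⟨ sym (sumBelow-+ (suc k) (λ v → bit (starts (restrict E s) v)) (λ v → bit (starts (restrict E (compl s)) v))) ⟩
  sumBelow (suc k) (λ v → bit (starts (restrict E s) v) ℕ.+ bit (starts (restrict E (compl s)) v))
    ≤⟨ sumBelow-mono (suc k) point ⟩
  components k E ∎
  where
  open ℕP.≤-Reasoning
  point : ∀ v → bit (starts (restrict E s) v) ℕ.+ bit (starts (restrict E (compl s)) v) ℕ.≤ bit (starts E v)
  point zero = split-point false (E 0) false (s 0) (s 1) (λ ())
  point (suc u) = split-point (E u) (E (suc u)) (s u) (s (suc u)) (s (suc (suc u))) (r u)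

components-restrict-≤ : ∀ k E s → Respects E s → components k (restrict E (compl s)) ℕ.≤ components k E
components-restrict-≤ k E s r =
  ℕP.≤-trans (ℕP.m≤n+m _ (components k (restrict E s))) (components-split k E s r)

union-start : ∀ a b c → bit (a ∨ (b ∨ c)) ℕ.≤ bit a ℕ.+ (bit b ℕ.+ bit c)
union-start true _ _ = s≤s z≤n
union-start false true _ = s≤s z≤n
union-start false false c = ℕP.≤-refl

union-point : ∀ a b c a' b' c' →
              bit (not (a' ∨ (b' ∨ c')) ∧ (a ∨ (b ∨ c)))
              ℕ.≤ bit (not a' ∧ a) ℕ.+ (bit (not b' ∧ b) ℕ.+ bit (not c' ∧ c))
union-point _ _ _ true _ _ = z≤n
union-point _ _ _ false true _ = z≤n
union-point _ _ _ false false true = z≤n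
union-point a b c false false false = union-start a b c

components-∪ : ∀ k Y₁ Y₂ Y₃ →
               components k (λ i → Y₁ i ∨ (Y₂ i ∨ Y₃ i))
               ℕ.≤ components k Y₁ ℕ.+ (components k Y₂ ℕ.+ components k Y₃)
components-∪ k Y₁ Y₂ Y₃ = begin
  components k (λ i → Y₁ i ∨ (Y₂ i ∨ Y₃ i))
    ≤⟨ sumBelow-mono (suc k) point ⟩
  sumBelow (suc k) (λ v → st Y₁ v ℕ.+ (st Y₂ v ℕ.+ st Y₃ v))
    ≡⟨ sumBelow-+ (suc k) (st Y₁) _ ⟩
  components k Y₁ ℕ.+ sumBelow (suc k) (λ v → st Y₂ v ℕ.+ st Y₃ v)
    ≡⟨ cong (components k Y₁ ℕ.+_) (sumBelow-+ (suc k) (st Y₂) (st Y₃)) ⟩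
  components k Y₁ ℕ.+ (components k Y₂ ℕ.+ components k Y₃) ∎
  where
  open ℕP.≤-Reasoning
  st : EdgeSet → ℕ → ℕ
  st E v = bit (starts E v)
  point : ∀ v → st (λ i → Y₁ i ∨ (Y₂ i ∨ Y₃ i)) v ℕ.≤ st Y₁ v ℕ.+ (st Y₂ v ℕ.+ st Y₃ v)
  point zero = union-point (Y₁ 0) (Y₂ 0) (Y₃ 0) false false false
  point (suc u) = union-point (Y₁ (suc u)) (Y₂ (suc u)) (Y₃ (suc u)) (Y₁ u) (Y₂ u) (Y₃ u)

-- Covering: if Y ⊆ X and every edge of X is joined in X to an edge of Y, then
-- every run of X contains an edge of Y, so X has at most as many runs as Y.
-- The proof scans the edges left to right, tracking whether the current run
-- of X is still "pending", i.e. has not yet met an edge of Y.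

pending : EdgeSet → EdgeSet → ℕ → Bool
pending X Y zero = false
pending X Y (suc n) = X n ∧ (not (Y n) ∧ (not (before X n) ∨ pending X Y n))

pending-last : ∀ X Y m → pending X Y (suc m) ≡ true → X m ≡ true × Y m ≡ false
pending-last X Y m h with ∧-elim {X m} h
... | xm , rest = xm , not-elim (proj₁ (∧-elim {not (Y m)} rest))

pending-avoids : ∀ X Y m → pending X Y (suc m) ≡ true →
                 ∀ j → j ℕ.≤ m → (∀ x → j ℕ.≤ x → x ℕ.< m → X x ≡ true) → Y j ≡ false
pending-avoids X Y zero h .zero z≤n run = proj₂ (pending-last X Y zero h)
pending-avoids X Y (suc m) h j j≤ run with ℕP.m≤n⇒m<n∨m≡n j≤
... | inj₂ refl = proj₂ (pending-last X Y (suc m) h)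
... | inj₁ j<sm = pending-avoids X Y m earlier j (ℕP.m<1+n⇒m≤n j<sm) (λ x l u → run x l (ℕP.m≤n⇒m≤1+n u))
  where
  earlier : pending X Y (suc m) ≡ true
  earlier with ∨-elim {not (X m)} (proj₂ (∧-elim {not (Y (suc m))} (proj₂ (∧-elim {X (suc m)} h))))
  ... | inj₁ nx = ⊥-elim (true≢false (run m (ℕP.m<1+n⇒m≤n j<sm) (ℕP.n<1+n m)) (not-elim nx))
  ... | inj₂ p = p

before-⊆ : ∀ X Y → Y ⊆ᴱ X → ∀ n → before Y n ≡ true → before X n ≡ true
before-⊆ X Y Y⊆X zero = λ ()
before-⊆ X Y Y⊆X (suc m) = Y⊆X m

pending-before : ∀ X Y n → pending X Y n ≡ true → before X n ≡ true × before Y n ≡ false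
pending-before X Y zero = λ ()
pending-before X Y (suc m) = pending-last X Y m

run-point : ∀ x₀ x₁ y₀ y₁ p → (y₁ ≡ true → x₁ ≡ true) → (y₀ ≡ true → x₀ ≡ true) →
            (p ≡ true → x₀ ≡ true) → (p ≡ true → y₀ ≡ false) → (x₁ ≡ false → p ≡ false) →
            bit (not x₀ ∧ x₁) ℕ.+ bit p ℕ.≤ bit (not y₀ ∧ y₁) ℕ.+ bit (x₁ ∧ (not y₁ ∧ (not x₀ ∨ p)))
run-point false true false true false _ _ _ _ _ = s≤s z≤n
run-point false true false false false _ _ _ _ _ = s≤s z≤n
run-point false false _ false false _ _ _ _ _ = z≤n
run-point false false _ true _ h₁ _ _ _ _ = ⊥-elim (true≢false (h₁ refl) refl)
run-point false _ true _ _ _ h₂ _ _ _ = ⊥-elim (true≢false (h₂ refl) refl)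
run-point false _ false _ true _ _ h₃ _ _ = ⊥-elim (true≢false (h₃ refl) refl)
run-point true _ _ _ false _ _ _ _ _ = z≤n
run-point true true false true true _ _ _ _ _ = s≤s z≤n
run-point true true false false true _ _ _ _ _ = s≤s z≤n
run-point true false _ _ true _ _ _ _ h₅ = ⊥-elim (true≢false refl (h₅ refl))
run-point true _ true _ true _ _ _ h₄ _ = ⊥-elim (true≢false refl (h₄ refl))

module Covering (X Y : EdgeSet) (Y⊆X : Y ⊆ᴱ X)
                (reach : ∀ i → X i ≡ true → Σ ℕ λ j → Y j ≡ true × Joined X i j) where

  runs : EdgeSet → ℕ → ℕ
  runs E n = sumBelow n (λ v → bit (starts E v))

  -- A pending run cannot end: the edge of Y its edges are joined to lies beyond.
  pending-cannot-end : ∀ m → pending X Y (suc m) ≡ true → X (suc m) ≡ false → ⊥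
  pending-cannot-end m p xf with reach m (proj₁ (pending-last X Y m p))
  ... | j , yj , jn with ℕP.<-cmp j (suc m)
  ... | tri≈ _ refl _ = true≢false (Y⊆X j yj) xf
  ... | tri> _ _ sm<j =
    true≢false (jn (suc m) (ℕP.≤-trans (ℕP.m⊓n≤m m j) (ℕP.n≤1+n m))
                (subst (suc m ℕ.<_) (sym (ℕP.m≤n⇒m⊔n≡n (ℕP.<⇒≤ (ℕP.<-trans (ℕP.n<1+n m) sm<j)))) sm<j)) xf
  ... | tri< j<sm _ _ =
    true≢false yj (pending-avoids X Y m p j j≤m
      (λ x l u → jn x (subst (ℕ._≤ x) (sym (ℕP.m≥n⇒m⊓n≡n j≤m)) l) (subst (x ℕ.<_) (sym (ℕP.m≥n⇒m⊔n≡m j≤m)) u)))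
    where j≤m = ℕP.m<1+n⇒m≤n j<sm

  pending-stops : ∀ n → X n ≡ false → pending X Y n ≡ false
  pending-stops zero xf = refl
  pending-stops (suc m) xf = false-unless (λ pm → pending-cannot-end m pm xf)

  -- Each run of X either is paid for by a run of Y starting at the same edge
  -- or is still pending.
  invariant : ∀ n → runs X n ℕ.≤ runs Y n ℕ.+ bit (pending X Y n)
  invariant zero = z≤n
  invariant (suc n) = begin
    sx ℕ.+ runs X n ≤⟨ ℕP.+-monoʳ-≤ sx (invariant n) ⟩
    sx ℕ.+ (runs Y n ℕ.+ p) ≡⟨ rearrange sx (runs Y n) p ⟩
    (sx ℕ.+ p) ℕ.+ runs Y n ≤⟨ ℕP.+-monoˡ-≤ (runs Y n) step ⟩
    (sy ℕ.+ p') ℕ.+ runs Y n ≡⟨ sym (rearrange sy (runs Y n) p') ⟩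
    sy ℕ.+ (runs Y n ℕ.+ p') ≡⟨ sym (ℕP.+-assoc sy (runs Y n) p') ⟩
    (sy ℕ.+ runs Y n) ℕ.+ p' ∎
    where
    open ℕP.≤-Reasoning
    sx = bit (starts X n)
    sy = bit (starts Y n)
    p = bit (pending X Y n)
    p' = bit (pending X Y (suc n))
    rearrange : ∀ a b c → a ℕ.+ (b ℕ.+ c) ≡ (a ℕ.+ c) ℕ.+ b
    rearrange a b c = trans (cong (a ℕ.+_) (ℕP.+-comm b c)) (sym (ℕP.+-assoc a c b))
    step : sx ℕ.+ p ℕ.≤ sy ℕ.+ p'
    step = run-point (before X n) (X n) (before Y n) (Y n) (pending X Y n) (Y⊆X n) (before-⊆ X Y Y⊆X n)
             (λ q → proj₁ (pending-before X Y n q)) (λ q → proj₂ (pending-before X Y n q)) (pending-stops n)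

components-cover : ∀ k X Y → Y ⊆ᴱ X → (∀ i → X i ≡ true → Σ ℕ λ j → Y j ≡ true × Joined X i j) →
                   X k ≡ false → components k X ℕ.≤ components k Y
components-cover k X Y Y⊆X reach xk = begin
  components k X ≤⟨ invariant (suc k) ⟩
  components k Y ℕ.+ bit (pending X Y (suc k)) ≡⟨ cong (λ b → components k Y ℕ.+ bit b) no-pending ⟩
  components k Y ℕ.+ 0 ≡⟨ ℕP.+-identityʳ _ ⟩
  components k Y ∎
  where
  open ℕP.≤-Reasoning
  open Covering X Y Y⊆X reach
  no-pending : pending X Y (suc k) ≡ false
  no-pending = false-unless (λ p → true≢false (proj₁ (pending-last X Y k p)) xk)

≡ᵇ-true : ∀ m n → (m ≡ᵇ n) ≡ true → m ≡ n
≡ᵇ-true m n h = ℕP.≡ᵇ⇒≡ m n (subst T (sym h) tt)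

≡ᵇ-refl : ∀ n → (n ≡ᵇ n) ≡ true
≡ᵇ-refl zero = refl
≡ᵇ-refl (suc n) = ≡ᵇ-refl n

any-++ : ∀ {A : Set} (p : A → Bool) xs ys → any p (xs ++ ys) ≡ any p xs ∨ any p ys
any-++ p [] ys = refl
any-++ p (x ∷ xs) ys = trans (cong (p x ∨_) (any-++ p xs ys)) (sym (BP.∨-assoc (p x) _ _))

inE-node : ∀ {k} (A B : Tree k) i → inE ⟪ A , B ⟫ i ≡ inE (tree A) i ∨ inE (tree B) i
inE-node A B i = any-++ _ (labelsT A) (labelsT B)

labels-pair : ∀ {k} (X Y : Pattern k) → labels (pair X Y) ≡ labels X ++ labels Y
labels-pair ∅ Y = refl
labels-pair (tree X) ∅ = sym (LP.++-identityʳ (labelsT X))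
labels-pair (tree X) (tree Y) = refl

inE-pair : ∀ {k} (X Y : Pattern k) i → inE (pair X Y) i ≡ inE X i ∨ inE Y i
inE-pair X Y i = trans (cong (any (λ e → toℕ e ≡ᵇ i)) (labels-pair X Y)) (any-++ _ (labels X) (labels Y))

inE-leaf : ∀ {k} (e : Fin k) → inE (tree (leaf e)) (toℕ e) ≡ true
inE-leaf e = cong (_∨ false) (≡ᵇ-refl (toℕ e))

inE-⪯ : ∀ {k} {A' A : Tree k} → A' ⪯ A → inE (tree A') ⊆ᴱ inE (tree A)
inE-⪯ here i x = x
inE-⪯ {A = node A B} (left p) i x = trans (inE-node A B i) (∨-introˡ _ (inE-⪯ p i x))
inE-⪯ {A = node A B} (right p) i x = trans (inE-node A B i) (∨-introʳ (inE (tree A) i) (inE-⪯ p i x))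

inE-node-⊆ : ∀ {k} (A B : Tree k) (P : Pattern k) →
             inE (tree A) ⊆ᴱ inE P → inE (tree B) ⊆ᴱ inE P → inE ⟪ A , B ⟫ ⊆ᴱ inE P
inE-node-⊆ A B P sA sB i h with ∨-elim {inE (tree A) i} (trans (sym (inE-node A B i)) h)
... | inj₁ x = sA i x
... | inj₂ x = sB i x

inE-bound : ∀ {k} (P : Pattern k) i → inE P i ≡ true → i ℕ.< k
inE-bound {k} P i = go (labels P)
  where
  go : ∀ (l : List (Fin k)) → any (λ e → toℕ e ≡ᵇ i) l ≡ true → i ℕ.< k
  go (e ∷ l) h with ∨-elim {toℕ e ≡ᵇ i} h
  ... | inj₁ x = subst (ℕ._< k) (≡ᵇ-true _ _ x) (FP.toℕ<n e)
  ... | inj₂ x = go l x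

inE-last : ∀ {k} (P : Pattern k) → inE P k ≡ false
inE-last {k} P = false-unless (λ t → ℕP.<-irrefl refl (inE-bound P k t))

vertex-bound : ∀ {k} (P : Pattern k) w → vertex (inE P) w ≡ true → w ℕ.< suc k
vertex-bound P w h with vertex-incident (inE P) w h
... | j , e , inj₁ refl = ℕP.m≤n⇒m≤1+n (inE-bound P j e)
... | j , e , inj₂ refl = s≤s (inE-bound P j e)

inV-vertex : ∀ {k} (P : Pattern k) v → inV P v ≡ vertex (inE P) v
inV-vertex P zero = refl
inV-vertex P (suc v) = refl

-- Keeping the leaves of a tree whose labels satisfy f, pruning as in ↾.
-- Both A ↾ S and A ⊖ B are of this form.

keepLeaves : ∀ {k} → (Fin k → Bool) → Tree k → Pattern k
keepLeaves f (leaf e) = if f e then tree (leaf e) else ∅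
keepLeaves f (node A B) = pair (keepLeaves f A) (keepLeaves f B)

keep : ∀ {k} → (Fin k → Bool) → Pattern k → Pattern k
keep f ∅ = ∅
keep f (tree t) = keepLeaves f t

bothIn : ∀ {k} → (ℕ → Bool) → Fin k → Bool
bothIn s e = s (toℕ e) ∧ s (suc (toℕ e))

↾-keep : ∀ {k} (P : Pattern k) S → P ↾ S ≡ keep (λ e → lookup S (inject₁ e) ∧ lookup S (fsuc e)) P
↾-keep ∅ S = refl
↾-keep (tree t) S = go t
  where
  go : ∀ t → restrictT t S ≡ keepLeaves (λ e → lookup S (inject₁ e) ∧ lookup S (fsuc e)) t
  go (leaf e) = refl
  go (node A B) = cong₂ pair (go A) (go B)

keepLeaves-ext : ∀ {k} (t : Tree k) f g → (∀ e → inE (tree t) (toℕ e) ≡ true → f e ≡ g e) →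
                 keepLeaves f t ≡ keepLeaves g t
keepLeaves-ext (leaf e) f g h = cong (λ b → if b then tree (leaf e) else ∅) (h e (inE-leaf e))
keepLeaves-ext (node A B) f g h =
  cong₂ pair (keepLeaves-ext A f g (λ e x → h e (trans (inE-node A B (toℕ e)) (∨-introˡ _ x))))
             (keepLeaves-ext B f g (λ e x → h e (trans (inE-node A B (toℕ e)) (∨-introʳ (inE (tree A) (toℕ e)) x))))

keep-ext : ∀ {k} (P : Pattern k) f g → (∀ e → f e ≡ g e) → keep f P ≡ keep g P
keep-ext ∅ f g h = refl
keep-ext (tree t) f g h = keepLeaves-ext t f g (λ e _ → h e)

pair-∅ : ∀ {k} (X : Pattern k) → pair X ∅ ≡ X
pair-∅ ∅ = refl
pair-∅ (tree X) = refl

keep-pair : ∀ {k} g (X Y : Pattern k) → keep g (pair X Y) ≡ pair (keep g X) (keep g Y)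
keep-pair g ∅ Y = refl
keep-pair g (tree X) ∅ = sym (pair-∅ (keepLeaves g X))
keep-pair g (tree X) (tree Y) = refl

keep-keepLeaves : ∀ {k} (t : Tree k) f g → keep g (keepLeaves f t) ≡ keepLeaves (λ e → f e ∧ g e) t
keep-keepLeaves (leaf e) f g with f e
... | true = refl
... | false = refl
keep-keepLeaves (node A B) f g =
  trans (keep-pair g (keepLeaves f A) (keepLeaves f B)) (cong₂ pair (keep-keepLeaves A f g) (keep-keepLeaves B f g))

inE-keepLeaves : ∀ {k} (t : Tree k) p i → inE (keepLeaves (bothIn p) t) i ≡ restrict (inE (tree t)) p i
inE-keepLeaves (leaf e) p i = trans (inE-if (bothIn p e)) (label-test (toℕ e))
  where
  inE-if : ∀ b → inE (if b then tree (leaf e) else ∅) i ≡ (toℕ e ≡ᵇ i) ∧ b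
  inE-if true = trans (BP.∨-identityʳ _) (sym (BP.∧-identityʳ _))
  inE-if false = sym (BP.∧-zeroʳ _)
  label-test : ∀ n → (n ≡ᵇ i) ∧ (p n ∧ p (suc n)) ≡ ((n ≡ᵇ i) ∨ false) ∧ (p i ∧ p (suc i))
  label-test n with n ≡ᵇ i in eq
  ... | true = cong (λ x → p x ∧ p (suc x)) (≡ᵇ-true n i eq)
  ... | false = refl
inE-keepLeaves (node A B) p i = begin
  inE (pair (keepLeaves (bothIn p) A) (keepLeaves (bothIn p) B)) i
    ≡⟨ inE-pair (keepLeaves (bothIn p) A) (keepLeaves (bothIn p) B) i ⟩
  inE (keepLeaves (bothIn p) A) i ∨ inE (keepLeaves (bothIn p) B) i
    ≡⟨ cong₂ _∨_ (inE-keepLeaves A p i) (inE-keepLeaves B p i) ⟩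
  restrict (inE (tree A)) p i ∨ restrict (inE (tree B)) p i
    ≡⟨ sym (BP.∧-distribʳ-∨ _ (inE (tree A) i) (inE (tree B) i)) ⟩
  (inE (tree A) i ∨ inE (tree B) i) ∧ (p i ∧ p (suc i))
    ≡⟨ cong (_∧ (p i ∧ p (suc i))) (sym (inE-node A B i)) ⟩
  restrict (inE ⟪ A , B ⟫) p i ∎
  where open ≡-Reasoning

inE-keep : ∀ {k} (P : Pattern k) p i → inE (keep (bothIn p) P) i ≡ restrict (inE P) p i
inE-keep ∅ p i = refl
inE-keep (tree t) p i = inE-keepLeaves t p i

edgesIn⇒ : ∀ {k} (P : Pattern k) lo n → edgesIn P lo n ≡ true →
           ∀ x → lo ℕ.≤ x → x ℕ.< lo ℕ.+ n → inE P x ≡ true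
edgesIn⇒ P lo zero h x l u = ⊥-elim (ℕP.<-irrefl refl (ℕP.≤-<-trans l (subst (x ℕ.<_) (ℕP.+-identityʳ lo) u)))
edgesIn⇒ P lo (suc n) h x l u with ∧-elim {inE P lo} h | ℕP.m≤n⇒m<n∨m≡n l
... | first , _ | inj₂ refl = first
... | _ , rest | inj₁ lo<x = edgesIn⇒ P (suc lo) n rest x lo<x (subst (x ℕ.<_) (ℕP.+-suc lo n) u)

edgesIn⇐ : ∀ {k} (P : Pattern k) lo n → (∀ x → lo ℕ.≤ x → x ℕ.< lo ℕ.+ n → inE P x ≡ true) →
           edgesIn P lo n ≡ true
edgesIn⇐ P lo zero h = refl
edgesIn⇐ P lo (suc n) h =
  ∧-intro (h lo ℕP.≤-refl (subst (lo ℕ.<_) (sym (ℕP.+-suc lo n)) (ℕP.m≤m+n (suc lo) n)))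
          (edgesIn⇐ P (suc lo) n (λ x l u → h x (ℕP.<⇒≤ l) (subst (x ℕ.<_) (sym (ℕP.+-suc lo n)) u)))

lo+span : ∀ u w → u ⊓ w ℕ.+ ((u ⊔ w) ∸ (u ⊓ w)) ≡ u ⊔ w
lo+span u w = ℕP.m+[n∸m]≡n (ℕP.m⊓n≤m⊔n u w)

conn⇒joined : ∀ {k} (P : Pattern k) u w → conn P u w ≡ true → Joined (inE P) u w
conn⇒joined P u w h with ∧-elim {inV P u} h
... | _ , rest = λ x l m →
  edgesIn⇒ P (u ⊓ w) _ (proj₂ (∧-elim {inV P w} rest)) x l (subst (x ℕ.<_) (sym (lo+span u w)) m)

joined⇒conn : ∀ {k} (P : Pattern k) u w → vertex (inE P) u ≡ true → vertex (inE P) w ≡ true →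
              Joined (inE P) u w → conn P u w ≡ true
joined⇒conn P u w vu vw j =
  ∧-intro (trans (inV-vertex P u) vu) (∧-intro (trans (inV-vertex P w) vw)
    (edgesIn⇐ P (u ⊓ w) _ (λ x l m → j x l (subst (x ℕ.<_) (lo+span u w) m))))

-- c(P) counts the runs of G_P: the least vertex of a component is the left
-- end of its first edge.

least-vertex-starts : ∀ {k} (P : Pattern k) v →
                      (inV P v ∧ not (anyBelow v (λ w → conn P w v))) ≡ starts (inE P) v
least-vertex-starts P zero = BP.∧-identityʳ _
least-vertex-starts P (suc u) with bool-cases (inE P u)
... | inj₂ t = begin
  inV P (suc u) ∧ not (anyBelow (suc u) (λ w → conn P w (suc u)))
    ≡⟨ cong (λ b → inV P (suc u) ∧ not b) joined-below ⟩
  inV P (suc u) ∧ false ≡⟨ BP.∧-zeroʳ _ ⟩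
  false ≡⟨ cong (λ b → not b ∧ inE P (suc u)) (sym t) ⟩
  starts (inE P) (suc u) ∎
  where
  open ≡-Reasoning
  joined-below : anyBelow (suc u) (λ w → conn P w (suc u)) ≡ true
  joined-below = anyBelow-intro (suc u) _ u (ℕP.n<1+n u)
    (joined⇒conn P u (suc u) (vertex-here (inE P) u t) (vertex-next (inE P) u t) (joined-edge (inE P) u t))
... | inj₁ f = begin
  inV P (suc u) ∧ not (anyBelow (suc u) (λ w → conn P w (suc u)))
    ≡⟨ cong (λ b → inV P (suc u) ∧ not b) none-below ⟩
  inV P (suc u) ∧ true ≡⟨ BP.∧-identityʳ _ ⟩
  inE P (suc u) ∨ inE P u ≡⟨ cong (inE P (suc u) ∨_) f ⟩
  inE P (suc u) ∨ false ≡⟨ BP.∨-identityʳ _ ⟩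
  inE P (suc u) ≡⟨ cong (λ b → not b ∧ inE P (suc u)) (sym f) ⟩
  starts (inE P) (suc u) ∎
  where
  open ≡-Reasoning
  none-below : anyBelow (suc u) (λ w → conn P w (suc u)) ≡ false
  none-below = anyBelow-none (suc u) _ λ w w<su → false-unless λ cw →
    true≢false (conn⇒joined P w (suc u) cw u (ℕP.≤-trans (ℕP.m⊓n≤m w (suc u)) (ℕP.m<1+n⇒m≤n w<su))
                                             (ℕP.<-≤-trans (ℕP.n<1+n u) (ℕP.m≤n⊔m w (suc u)))) f

c≡components : ∀ {k} (P : Pattern k) → c P ≡ components k (inE P)
c≡components {k} P =
  trans (countBelow-sum (suc k) _) (sumBelow-ext (suc k) (λ v → cong bit (least-vertex-starts P v)))

c-restrict : ∀ {k} (P : Pattern k) p → c (keep (bothIn p) P) ≡ components k (restrict (inE P) p)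
c-restrict {k} P p = trans (c≡components (keep (bothIn p) P)) (components-ext k _ _ (inE-keep P p))

detached : ∀ {k} → Pattern k → Pattern k → ℕ → Bool
detached {k} P Q v = inV P v ∧ not (anyBelow (suc k) (λ w → conn P v w ∧ inV Q w))

⊖-keep : ∀ {k} (P Q : Pattern k) → P ⊖ Q ≡ keep (bothIn (detached P Q)) P
⊖-keep P Q = trans (↾-keep P _) (keep-ext P _ _ (λ e → cong₂ _∧_
  (trans (VP.lookup∘tabulate (λ v → detached P Q (toℕ v)) (inject₁ e)) (cong (detached P Q) (FP.toℕ-inject₁ e)))
  (VP.lookup∘tabulate (λ v → detached P Q (toℕ v)) (fsuc e))))

inE-⊖ : ∀ {k} (P Q : Pattern k) i → inE (P ⊖ Q) i ≡ restrict (inE P) (detached P Q) i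
inE-⊖ P Q i = trans (cong (λ X → inE X i) (⊖-keep P Q)) (inE-keep P (detached P Q) i)

detached-elim : ∀ {k} (P Q : Pattern k) v → detached P Q v ≡ true →
                ∀ w → w ℕ.< suc k → conn P v w ≡ true → inV Q w ≡ false
detached-elim P Q v h w w< cn =
  ∧-false-elim cn (anyBelow-none⁻ _ _ (not-elim (proj₂ (∧-elim {inV P v} h))) w w<)

detached-intro : ∀ {k} (P Q : Pattern k) v → inV P v ≡ true →
                 (∀ w → w ℕ.< suc k → conn P v w ≡ true → inV Q w ≡ false) → detached P Q v ≡ true
detached-intro P Q v iv h = ∧-intro iv (not-intro (anyBelow-none _ _ λ w w< →
  false-unless λ t → true≢false (proj₂ (∧-elim {conn P v w} t)) (h w w< (proj₁ (∧-elim {conn P v w} t)))))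

⊖-elim : ∀ {k} (P Q : Pattern k) i → inE (P ⊖ Q) i ≡ true →
         inE P i ≡ true × (∀ w → Joined (inE P) i w → vertex (inE Q) w ≡ false)
⊖-elim P Q i h with ∧-elim {inE P i} (trans (sym (inE-⊖ P Q i)) h)
... | ei , ends = ei , λ w jw → trans (sym (inV-vertex Q w))
      (detached-elim P Q i (proj₁ (∧-elim {detached P Q i} ends)) w (vertex-bound P w (joined-vertex (inE P) i w ei jw))
        (joined⇒conn P i w (vertex-here (inE P) i ei) (joined-vertex (inE P) i w ei jw) jw))

⊖-intro : ∀ {k} (P Q : Pattern k) i → inE P i ≡ true →
          (∀ w → Joined (inE P) i w → vertex (inE Q) w ≡ false) → inE (P ⊖ Q) i ≡ true
⊖-intro P Q i ei h = trans (inE-⊖ P Q i) (∧-intro ei (∧-intro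
  (detached-intro P Q i (trans (inV-vertex P i) (vertex-here (inE P) i ei))
    (λ w _ cn → trans (inV-vertex Q w) (h w (conn⇒joined P i w cn))))
  (detached-intro P Q (suc i) (trans (inV-vertex P (suc i)) (vertex-next (inE P) i ei))
    (λ w _ cn → trans (inV-vertex Q w)
      (h w (joined-trans (inE P) i (suc i) w (joined-edge (inE P) i ei) (conn⇒joined P (suc i) w cn)))))))

⊖-⊆ : ∀ {k} (P Q : Pattern k) → inE (P ⊖ Q) ⊆ᴱ inE P
⊖-⊆ P Q i h = proj₁ (⊖-elim P Q i h)

-- Restricting to a respected side commutes with ⊖: if P', Q' have the
-- s-side parts of G_P, G_Q as graphs, then G_{P' ⊖ Q'} is the s-side part of
-- G_{P ⊖ Q}.  (A component on the s-side of P meets V_Q iff it meets V_{Q'}.)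
⊖-restrict : ∀ {k} (P Q P' Q' : Pattern k) s → Respects (inE P) s → Respects (inE Q) s →
             (∀ i → inE P' i ≡ restrict (inE P) s i) → (∀ i → inE Q' i ≡ restrict (inE Q) s i) →
             ∀ i → inE (P' ⊖ Q') i ≡ restrict (inE (P ⊖ Q)) s i
⊖-restrict P Q P' Q' s rP rQ hP hQ i = bool-ext to from
  where
  P'⊆P : inE P' ⊆ᴱ inE P
  P'⊆P j x = restrict-⊆ (inE P) s j (trans (sym (hP j)) x)
  Q'⊆Q : inE Q' ⊆ᴱ inE Q
  Q'⊆Q j x = restrict-⊆ (inE Q) s j (trans (sym (hQ j)) x)
  to : inE (P' ⊖ Q') i ≡ true → restrict (inE (P ⊖ Q)) s i ≡ true
  to h with ⊖-elim P' Q' i h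
  ... | e' , avoids with ∧-elim {inE P i} (trans (sym (hP i)) e')
  ... | ep , ss = ∧-intro (⊖-intro P Q i ep avoids-Q) ss
    where
    avoids-Q : ∀ w → Joined (inE P) i w → vertex (inE Q) w ≡ false
    avoids-Q w jw = false-unless λ vq → true≢false
      (trans (vertex-ext (inE Q') (restrict (inE Q) s) hQ w)
        (vertex-restrict (inE Q) s rQ w (trans (sym (respects-joined (inE P) s rP i w jw)) (proj₁ (∧-elim {s i} ss))) vq))
      (avoids w (joined-mono _ _ (λ j x → trans (hP j) x) i w
        (joined-restrict (inE P) s rP i w jw (proj₁ (∧-elim {s i} ss)))))
  from : restrict (inE (P ⊖ Q)) s i ≡ true → inE (P' ⊖ Q') i ≡ true
  from h with ∧-elim {inE (P ⊖ Q) i} h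
  ... | m , ss with ⊖-elim P Q i m
  ... | ep , avoids = ⊖-intro P' Q' i (trans (hP i) (∧-intro ep ss)) λ w jw →
        false-unless λ vq' → true≢false (vertex-mono (inE Q') (inE Q) Q'⊆Q w vq')
                                         (avoids w (joined-mono (inE P') (inE P) P'⊆P i w jw))

component-avoids : ∀ {k} (C R : Pattern k) i → inE C i ≡ true →
                   anyBelow (suc k) (λ w → conn C i w ∧ inV R w) ≡ false →
                   ∀ w → Joined (inE C) i w → vertex (inE R) w ≡ false
component-avoids {k} C R i ei none w jw = trans (sym (inV-vertex R w))
  (∧-false-elim (joined⇒conn C i w (vertex-here (inE C) i ei) (joined-vertex (inE C) i w ei jw) jw)
                (anyBelow-none⁻ (suc k) _ none w (vertex-bound C w (joined-vertex (inE C) i w ei jw))))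

component-meets : ∀ {k} (C R : Pattern k) → inE R ⊆ᴱ inE C → ∀ i →
                  anyBelow (suc k) (λ w → conn C i w ∧ inV R w) ≡ true →
                  Σ ℕ λ j → inE R j ≡ true × Joined (inE C) i j
component-meets {k} C R R⊆C i meets with anyBelow-witness (suc k) _ meets
... | w , _ , cw with ∧-elim {conn C i w} cw
... | cn , vr with vertex-joined (inE R) w (trans (sym (inV-vertex R w)) vr)
... | j , ej , jwj = j , ej , joined-trans (inE C) i w j (conn⇒joined C i w cn) (joined-mono (inE R) (inE C) R⊆C w j jwj)

-- The complement-side runs of C are covered by those of A, of B ⊖ A and of
-- C ⊖ Q, where G_Q = G_A ∪ G_B ⊆ G_C: a component of C either meets V_A, or
-- meets V_B but not V_A, or meets neither.
compl-cover : ∀ {k} (C A B Q : Pattern k) s → Respects (inE C) s →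
              inE A ⊆ᴱ inE C → inE B ⊆ᴱ inE C → (∀ i → inE Q i ≡ inE A i ∨ inE B i) →
              components k (restrict (inE C) (compl s))
              ℕ.≤ components k (restrict (inE A) (compl s))
                  ℕ.+ (components k (restrict (inE (B ⊖ A)) (compl s)) ℕ.+ components k (restrict (inE (C ⊖ Q)) (compl s)))
compl-cover {k} C A B Q s rC A⊆C B⊆C hQ =
  ℕP.≤-trans (components-cover k X Y Y⊆X reach (cong (_∧ (q k ∧ q (suc k))) (inE-last C))) (components-∪ k Y₁ Y₂ Y₃)
  where
  q = compl s
  EC = inE C
  X = restrict EC q
  Y₁ = restrict (inE A) q
  Y₂ = restrict (inE (B ⊖ A)) q
  Y₃ = restrict (inE (C ⊖ Q)) q
  Y : EdgeSet
  Y i = Y₁ i ∨ (Y₂ i ∨ Y₃ i)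
  rq : Respects EC q
  rq = respects-compl EC s rC
  Y⊆X : Y ⊆ᴱ X
  Y⊆X i h with ∨-elim {Y₁ i} h
  ... | inj₁ x = restrict-mono (inE A) EC q A⊆C i x
  ... | inj₂ x with ∨-elim {Y₂ i} x
  ... | inj₁ y = restrict-mono (inE (B ⊖ A)) EC q (λ j z → B⊆C j (⊖-⊆ B A j z)) i y
  ... | inj₂ y = restrict-mono (inE (C ⊖ Q)) EC q (⊖-⊆ C Q) i y
  q-side : ∀ i j → q i ≡ true → EC j ≡ true → Joined EC i j → q j ∧ q (suc j) ≡ true
  q-side i j qi ej jn = ∧-intro qj (trans (sym (rq j ej)) qj)
    where qj = trans (sym (respects-joined EC q rq i j jn)) qi
  reach : ∀ i → X i ≡ true → Σ ℕ λ j → Y j ≡ true × Joined X i j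
  reach i xi with ∧-elim {EC i} xi
  ... | ei , qq with ∧-elim {q i} qq
  ... | qi , qsi with bool-cases (anyBelow (suc k) (λ w → conn C i w ∧ inV A w))
  ... | inj₂ meetsA with component-meets C A A⊆C i meetsA
  ...   | j , ej , jn = j , ∨-introˡ _ (∧-intro ej (q-side i j qi (A⊆C j ej) jn)) , joined-restrict EC q rq i j jn qi
  reach i xi | ei , qq | qi , qsi | inj₁ missesA with bool-cases (anyBelow (suc k) (λ w → conn C i w ∧ inV B w))
  ... | inj₂ meetsB with component-meets C B B⊆C i meetsB
  ...   | j , ej , jn = j , ∨-introʳ (Y₁ j) (∨-introˡ _ (∧-intro inB⊖A (q-side i j qi (B⊆C j ej) jn)))
                          , joined-restrict EC q rq i j jn qi
    where
    inB⊖A : inE (B ⊖ A) j ≡ true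
    inB⊖A = ⊖-intro B A j ej λ w jw →
      component-avoids C A i ei missesA w (joined-trans EC i j w jn (joined-mono (inE B) EC B⊆C j w jw))
  reach i xi | ei , qq | qi , qsi | inj₁ missesA | inj₁ missesB =
    i , ∨-introʳ (Y₁ i) (∨-introʳ (Y₂ i) (∧-intro inC⊖Q (∧-intro qi qsi))) , joined-refl X i
    where
    inC⊖Q : inE (C ⊖ Q) i ≡ true
    inC⊖Q = ⊖-intro C Q i ei λ w jw → begin
      vertex (inE Q) w ≡⟨ vertex-ext (inE Q) (λ j → inE A j ∨ inE B j) hQ w ⟩
      vertex (λ j → inE A j ∨ inE B j) w ≡⟨ vertex-∨ (inE A) (inE B) w ⟩
      vertex (inE A) w ∨ vertex (inE B) w
        ≡⟨ cong₂ _∨_ (component-avoids C A i ei missesA w jw) (component-avoids C B i ei missesB w jw) ⟩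
      false ∎
      where open ≡-Reasoning

module RationalArithmetic where

  open import Data.Integer as ℤ using ()
  import Data.Integer.Properties as ℤP
  import Data.Nat.Coprimality as Coprime
  open import Data.Rational using (mkℚ; _-_; -_; 0ℚ; toℚᵘ)
  open import Data.Rational.Properties
  import Data.Rational.Unnormalised as U
  import Data.Rational.Unnormalised.Properties as UP
  open import Data.Rational.Solver
  open +-*-Solver

  N : ℕ → ℚ
  N = ℕ→ℚ

  N-canonical : ∀ n → N n ≡ mkℚ (ℤ.+ n) 0 (Coprime.sym (Coprime.1-coprimeTo n))
  N-canonical n = normalize-coprime (Coprime.sym (Coprime.1-coprimeTo n))

  N-+ : ∀ m n → N (m ℕ.+ n) ≡ N m + N n
  N-+ m n = toℚᵘ-injective (UP.≃-trans (canon (m ℕ.+ n)) (UP.≃-trans sum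
              (UP.≃-sym (UP.≃-trans (toℚᵘ-homo-+ (N m) (N n)) (UP.+-cong (canon m) (canon n))))))
    where
    canon : ∀ n → toℚᵘ (N n) U.≃ U.mkℚᵘ (ℤ.+ n) 0
    canon n = UP.≃-reflexive (cong toℚᵘ (N-canonical n))
    sum : U.mkℚᵘ (ℤ.+ (m ℕ.+ n)) 0 U.≃ (U.mkℚᵘ (ℤ.+ m) 0 U.+ U.mkℚᵘ (ℤ.+ n) 0)
    sum = U.*≡* (trans (ℤP.*-identityʳ (ℤ.+ (m ℕ.+ n))) (trans (ℤP.pos-+ m n)
            (trans (cong₂ ℤ._+_ (sym (ℤP.*-identityʳ (ℤ.+ m))) (sym (ℤP.*-identityʳ (ℤ.+ n)))) (sym (ℤP.*-identityʳ _)))))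

  N-mono : ∀ {m n} → m ℕ.≤ n → N m ≤ N n
  N-mono {m} {n} m≤n = subst (N m ≤_) (trans (sym (N-+ m (n ∸ m))) (cong N (ℕP.m+[n∸m]≡n m≤n))) m≤m+d
    where
    m≤m+d : N m ≤ N m + N (n ∸ m)
    m≤m+d = subst (_≤ N m + N (n ∸ m)) (+-identityʳ (N m))
              (+-monoʳ-≤ (N m) (nonNegative⁻¹ (N (n ∸ m)) {{normalize-nonNeg (n ∸ m) 1}}))

  move : ∀ a b c → a + b ≤ c → a ≤ c - b
  move a b c h = subst (_≤ c - b) (solve 2 (λ a b → (a :+ b) :- b := a) refl a b) (+-monoˡ-≤ (- b) h)

  move⁻ : ∀ a b c → a ≤ c - b → a + b ≤ c
  move⁻ a b c h = subst (a + b ≤_) (solve 2 (λ c b → (c :- b) :+ b := c) refl c b) (+-monoˡ-≤ b h)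

  open ≤-Reasoning

  assemble† : ∀ a'' a' C x y w y₁ y₂ z →
              a'' + N x ≤ a' → a' + N y + N w ≤ C → (y₁ ℕ.+ y₂) ℕ.+ z ℕ.≤ (x ℕ.+ y) ℕ.+ w →
              a'' + N y₁ + N y₂ + N z ≤ C
  assemble† a'' a' C x y w y₁ y₂ z h₁ h₂ h₃ = begin
    a'' + N y₁ + N y₂ + N z
      ≡⟨ solve 4 (λ a p q r → a :+ p :+ q :+ r := a :+ (p :+ q :+ r)) refl a'' (N y₁) (N y₂) (N z) ⟩
    a'' + (N y₁ + N y₂ + N z)
      ≡⟨ cong (a'' +_) (sym (trans (N-+ (y₁ ℕ.+ y₂) z) (cong (_+ N z) (N-+ y₁ y₂)))) ⟩
    a'' + N ((y₁ ℕ.+ y₂) ℕ.+ z) ≤⟨ +-monoʳ-≤ a'' (N-mono h₃) ⟩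
    a'' + N ((x ℕ.+ y) ℕ.+ w)
      ≡⟨ cong (a'' +_) (trans (N-+ (x ℕ.+ y) w) (cong (_+ N w) (N-+ x y))) ⟩
    a'' + (N x + N y + N w)
      ≡⟨ solve 4 (λ a p q r → a :+ (p :+ q :+ r) := a :+ p :+ q :+ r) refl a'' (N x) (N y) (N w) ⟩
    a'' + N x + N y + N w ≤⟨ +-monoˡ-≤ (N w) (+-monoˡ-≤ (N y) h₁) ⟩
    a' + N y + N w ≤⟨ h₂ ⟩
    C ∎

  assemble†₀ : ∀ a'' a' C x y w z →
               a'' + N x ≤ a' → a' + N y + N w ≤ C → z ℕ.≤ (x ℕ.+ y) ℕ.+ w → a'' + N z ≤ C
  assemble†₀ a'' a' C x y w z h₁ h₂ h₃ =
    subst (_≤ C) (solve 2 (λ a r → a :+ con 0ℚ :+ con 0ℚ :+ r := a :+ r) refl a'' (N z))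
      (assemble† a'' a' C x y w 0 0 z h₁ h₂ h₃)

  assemble‡ : ∀ a'' b'' a' b' C x y cX z cC d w cCAB →
              a'' + N x ≤ a' → b'' + N y ≤ b' → ½ * (a' + b' + N cC + N cCAB) ≤ C →
              cX ℕ.+ z ℕ.≤ cC → d ℕ.+ w ℕ.≤ cCAB → z ℕ.≤ x ℕ.+ (y ℕ.+ w) →
              ½ * (a'' + b'' + N cX + N d) + N z ≤ C
  assemble‡ a'' b'' a' b' C x y cX z cC d w cCAB h₁ h₂ h₃ h₄ h₅ h₆ = begin
    ½ * (a'' + b'' + N cX + N d) + N z
      ≡⟨ solve 5 (λ a b c d z → con ½ :* (a :+ b :+ c :+ d) :+ z := con ½ :* (a :+ b :+ c :+ d :+ (z :+ z)))
               refl a'' b'' (N cX) (N d) (N z) ⟩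
    ½ * (a'' + b'' + N cX + N d + (N z + N z))
      ≤⟨ *-monoˡ-≤-nonNeg ½ (+-monoʳ-≤ (a'' + b'' + N cX + N d) (+-monoʳ-≤ (N z) z≤)) ⟩
    ½ * (a'' + b'' + N cX + N d + (N z + (N x + (N y + N w))))
      ≡⟨ cong (½ *_) (solve 8 (λ a b c d z x y w →
            a :+ b :+ c :+ d :+ (z :+ (x :+ (y :+ w))) := (a :+ x) :+ (b :+ y) :+ (c :+ z) :+ (d :+ w))
            refl a'' b'' (N cX) (N d) (N z) (N x) (N y) (N w)) ⟩
    ½ * ((a'' + N x) + (b'' + N y) + (N cX + N z) + (N d + N w))
      ≤⟨ *-monoˡ-≤-nonNeg ½ (+-mono-≤ (+-mono-≤ (+-mono-≤ h₁ h₂) (subst (_≤ N cC) (N-+ cX z) (N-mono h₄)))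
                                       (subst (_≤ N cCAB) (N-+ d w) (N-mono h₅))) ⟩
    ½ * (a' + b' + N cC + N cCAB) ≤⟨ h₃ ⟩
    C ∎
    where
    z≤ : N z ≤ N x + (N y + N w)
    z≤ = subst (N z ≤_) (trans (N-+ x (y ℕ.+ w)) (cong (N x +_) (N-+ y w))) (N-mono h₆)

open RationalArithmetic using (N; N-mono; move; move⁻; assemble†; assemble†₀; assemble‡)

size : ∀ {k} → Tree k → ℕ
size (leaf e) = 1
size (node A B) = size A ℕ.+ size B

sizeP : ∀ {k} → Pattern k → ℕ
sizeP ∅ = 0
sizeP (tree t) = size t

sizeP-pair : ∀ {k} (X Y : Pattern k) → sizeP (pair X Y) ≡ sizeP X ℕ.+ sizeP Y
sizeP-pair ∅ Y = refl
sizeP-pair (tree X) ∅ = sym (ℕP.+-identityʳ _)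
sizeP-pair (tree X) (tree Y) = refl

size-pos : ∀ {k} (t : Tree k) → 1 ℕ.≤ size t
size-pos (leaf e) = ℕP.≤-refl
size-pos (node A B) = ℕP.≤-trans (size-pos A) (ℕP.m≤m+n (size A) (size B))

size-⪯ : ∀ {k} {A' A : Tree k} → A' ⪯ A → size A' ℕ.≤ size A
size-⪯ here = ℕP.≤-refl
size-⪯ {A = node A B} (left p) = ℕP.≤-trans (size-⪯ p) (ℕP.m≤m+n (size A) (size B))
size-⪯ {A = node A B} (right p) = ℕP.≤-trans (size-⪯ p) (ℕP.m≤n+m (size B) (size A))

size-keepLeaves : ∀ {k} f (t : Tree k) → sizeP (keepLeaves f t) ℕ.≤ size t
size-keepLeaves f (leaf e) with f e
... | true = ℕP.≤-refl
... | false = z≤n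
size-keepLeaves f (node A B) =
  subst (ℕ._≤ size A ℕ.+ size B) (sym (sizeP-pair (keepLeaves f A) (keepLeaves f B)))
        (ℕP.+-mono-≤ (size-keepLeaves f A) (size-keepLeaves f B))

size-⊖ : ∀ {k} (B : Tree k) Q → sizeP (tree B ⊖ Q) ℕ.≤ size B
size-⊖ B Q = subst (ℕ._≤ size B) (cong sizeP (sym (⊖-keep (tree B) Q))) (size-keepLeaves _ B)

keepLeaves-⪯ : ∀ {k} f (A T : Tree k) → keepLeaves f A ≡ tree T →
               ∀ A'' → A'' ⪯ T → Σ (Tree k) λ A' → A' ⪯ A × keepLeaves f A' ≡ tree A''
keepLeaves-⪯ f (leaf e) T eq A'' p with f e in fe
keepLeaves-⪯ f (leaf e) .(leaf e) refl .(leaf e) here | true =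
  leaf e , here , cong (λ b → if b then tree (leaf e) else ∅) fe
keepLeaves-⪯ f (node A₁ A₂) T eq A'' p with keepLeaves f A₁ in e₁ | keepLeaves f A₂ in e₂
... | ∅ | Y with keepLeaves-⪯ f A₂ T (trans e₂ eq) A'' p
...   | A' , q , r = A' , right q , r
keepLeaves-⪯ f (node A₁ A₂) T eq A'' p | tree T₁ | ∅ with keepLeaves-⪯ f A₁ T (trans e₁ eq) A'' p
...   | A' , q , r = A' , left q , r
keepLeaves-⪯ f (node A₁ A₂) .(node T₁ T₂) refl A'' here | tree T₁ | tree T₂ =
  node A₁ A₂ , here , cong₂ pair e₁ e₂
keepLeaves-⪯ f (node A₁ A₂) .(node T₁ T₂) refl A'' (left p) | tree T₁ | tree T₂ with keepLeaves-⪯ f A₁ T₁ e₁ A'' p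
...   | A' , q , r = A' , left q , r
keepLeaves-⪯ f (node A₁ A₂) .(node T₁ T₂) refl A'' (right p) | tree T₁ | tree T₂ with keepLeaves-⪯ f A₂ T₂ e₂ A'' p
...   | A' , q , r = A' , right q , r

-- Patterns have decidable equality (needed to modify Φ at a single pattern).

_≟T_ : ∀ {k} (a b : Tree k) → Dec (a ≡ b)
leaf e ≟T leaf e' with e FP.≟ e'
... | yes refl = yes refl
... | no ne = no λ { refl → ne refl }
leaf e ≟T node _ _ = no λ ()
node _ _ ≟T leaf _ = no λ ()
node a b ≟T node a' b' with a ≟T a' | b ≟T b'
... | yes refl | yes refl = yes refl
... | no ne | _ = no λ { refl → ne refl }
... | yes _ | no ne = no λ { refl → ne refl }

_≟P_ : ∀ {k} (a b : Pattern k) → Dec (a ≡ b)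
∅ ≟P ∅ = yes refl
∅ ≟P tree _ = no λ ()
tree _ ≟P ∅ = no λ ()
tree a ≟P tree b with a ≟T b
... | yes refl = yes refl
... | no ne = no λ { refl → ne refl }

Constraints : ∀ {k} → (Pattern k → ℚ) → (A B A' B' : Tree k) → ℚ → Set
Constraints f A B A' B' R =
       (f (tree A') + cℚ (tree B ⊖ tree A') + cℚ (C ⊖ ⟪ A' , B ⟫) ≤ R)
     × (½ * (f (tree A') + f (tree B' ⊖ tree A') + cℚ C + cℚ (C ⊖ ⟪ A' , B' ⟫)) ≤ R)
     × (f (tree B') + cℚ (tree A ⊖ tree B') + cℚ (C ⊖ ⟪ B' , A ⟫) ≤ R)
     × (½ * (f (tree B') + f (tree A' ⊖ tree B') + cℚ C + cℚ (C ⊖ ⟪ B' , A' ⟫)) ≤ R)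
  where
  C = ⟪ A , B ⟫

constraints-antitone : ∀ {k} (f g : Pattern k → ℚ) A B A' B' R → (∀ P → g P ≤ f P) →
                       Constraints f A B A' B' R → Constraints g A B A' B' R
constraints-antitone f g A B A' B' R h (c₁ , c₂ , c₃ , c₄) =
  ℚP.≤-trans (ℚP.+-monoˡ-≤ _ (ℚP.+-monoˡ-≤ _ (h _))) c₁ ,
  ℚP.≤-trans (ℚP.*-monoˡ-≤-nonNeg ½ (ℚP.+-monoˡ-≤ _ (ℚP.+-monoˡ-≤ _ (ℚP.+-mono-≤ (h _) (h _))))) c₂ ,
  ℚP.≤-trans (ℚP.+-monoˡ-≤ _ (ℚP.+-monoˡ-≤ _ (h _))) c₃ ,
  ℚP.≤-trans (ℚP.*-monoˡ-≤-nonNeg ½ (ℚP.+-monoˡ-≤ _ (ℚP.+-monoˡ-≤ _ (ℚP.+-mono-≤ (h _) (h _))))) c₄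

constraints-⊓ : ∀ {k} (f : Pattern k → ℚ) A B A' B' R R' →
                Constraints f A B A' B' R → Constraints f A B A' B' R' → Constraints f A B A' B' (R ℚ.⊓ R')
constraints-⊓ f A B A' B' R R' (a₁ , a₂ , a₃ , a₄) (b₁ , b₂ , b₃ , b₄) =
  ℚP.⊓-glb a₁ b₁ , ℚP.⊓-glb a₂ b₂ , ℚP.⊓-glb a₃ b₃ , ℚP.⊓-glb a₄ b₄

-- Minimality of Φ as an upper-bound principle: if the defining inequalities
-- at X = {X₁ , X₂} all hold with M in place of Φ X, then Φ X ≤ M.  Indeed
-- lowering Φ at X to min(Φ X, M) keeps every inequality (Φ only decreases,
-- and at X both bounds hold), so by minimality Φ X ≤ min(Φ X, M).
module Lowering {k} (Φ : Pattern k → ℚ) (isΦ : IsΦ Φ) (X₁ X₂ : Tree k) (M : ℚ)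
                (bounds : ∀ A' B' → A' ⪯ X₁ → B' ⪯ X₂ → Constraints Φ X₁ X₂ A' B' M) where

  X : Pattern k
  X = ⟪ X₁ , X₂ ⟫

  pick : ∀ P → Dec (P ≡ X) → ℚ
  pick P (yes _) = Φ P ℚ.⊓ M
  pick P (no _) = Φ P

  lowered : Pattern k → ℚ
  lowered P = pick P (P ≟P X)

  lowered-cases : ∀ P → (P ≡ X × lowered P ≡ Φ P ℚ.⊓ M) ⊎ (¬ (P ≡ X) × lowered P ≡ Φ P)
  lowered-cases P = cases (P ≟P X)
    where
    cases : (d : Dec (P ≡ X)) → (P ≡ X × pick P d ≡ Φ P ℚ.⊓ M) ⊎ (¬ (P ≡ X) × pick P d ≡ Φ P)
    cases (yes P≡X) = inj₁ (P≡X , refl)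
    cases (no P≢X) = inj₂ (P≢X , refl)

  lowered≤Φ : ∀ P → lowered P ≤ Φ P
  lowered≤Φ P with lowered-cases P
  ... | inj₁ (_ , eq) = subst (_≤ Φ P) (sym eq) (ℚP.p⊓q≤p (Φ P) M)
  ... | inj₂ (_ , eq) = ℚP.≤-reflexive eq

  lowered-elsewhere : ∀ P → ¬ (P ≡ X) → lowered P ≡ Φ P
  lowered-elsewhere P P≢X with lowered-cases P
  ... | inj₁ (P≡X , _) = ⊥-elim (P≢X P≡X)
  ... | inj₂ (_ , eq) = eq

  constraints-by-cases : ∀ A B A' B' → A' ⪯ A → B' ⪯ B →
                         (⟪ A , B ⟫ ≡ X × lowered ⟪ A , B ⟫ ≡ Φ ⟪ A , B ⟫ ℚ.⊓ M)
                         ⊎ (¬ (⟪ A , B ⟫ ≡ X) × lowered ⟪ A , B ⟫ ≡ Φ ⟪ A , B ⟫) →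
                         Constraints lowered A B A' B' (lowered ⟪ A , B ⟫)
  constraints-by-cases A B A' B' p q (inj₁ (refl , eq)) = subst (Constraints lowered A B A' B') (sym eq)
    (constraints-antitone Φ lowered A B A' B' (Φ X ℚ.⊓ M) lowered≤Φ
      (constraints-⊓ Φ A B A' B' (Φ X) M (proj₂ (proj₂ (proj₁ isΦ)) A B A' B' p q) (bounds A' B' p q)))
  constraints-by-cases A B A' B' p q (inj₂ (_ , eq)) = subst (Constraints lowered A B A' B') (sym eq)
    (constraints-antitone Φ lowered A B A' B' (Φ ⟪ A , B ⟫) lowered≤Φ (proj₂ (proj₂ (proj₁ isΦ)) A B A' B' p q))

  lowered-admissible : Admissible lowered
  lowered-admissible =
    trans (lowered-elsewhere ∅ (λ ())) (proj₁ (proj₁ isΦ)) ,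
    (λ e → trans (lowered-elsewhere (tree (leaf e)) (λ ())) (proj₁ (proj₂ (proj₁ isΦ)) e)) ,
    (λ A B A' B' p q → constraints-by-cases A B A' B' p q (lowered-cases ⟪ A , B ⟫))
  Φ-below : Φ X ≤ M
  Φ-below with lowered-cases X
  ... | inj₁ (_ , eq) = ℚP.≤-trans (subst (Φ X ≤_) eq (proj₂ isΦ lowered lowered-admissible X)) (ℚP.p⊓q≤q (Φ X) M)
  ... | inj₂ (X≢X , _) = ⊥-elim (X≢X refl)

c-split : ∀ {k} (P P' : Pattern k) s → Respects (inE P) s → (∀ i → inE P' i ≡ restrict (inE P) s i) →
          c P' ℕ.+ components k (restrict (inE P) (compl s)) ℕ.≤ c P
c-split {k} P P' s r h =
  subst₂ (λ a b → a ℕ.+ components k (restrict (inE P) (compl s)) ℕ.≤ b)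
    (sym (trans (c≡components P') (components-ext k _ _ h))) (sym (c≡components P))
    (components-split k (inE P) s r)

c-⊖-split : ∀ {k} (P Q P' Q' : Pattern k) s → Respects (inE P) s → Respects (inE Q) s →
            (∀ i → inE P' i ≡ restrict (inE P) s i) → (∀ i → inE Q' i ≡ restrict (inE Q) s i) →
            c (P' ⊖ Q') ℕ.+ components k (restrict (inE (P ⊖ Q)) (compl s)) ℕ.≤ c (P ⊖ Q)
c-⊖-split P Q P' Q' s rP rQ hP hQ =
  c-split (P ⊖ Q) (P' ⊖ Q') s (respects-⊆ _ _ s (⊖-⊆ P Q) rP) (⊖-restrict P Q P' Q' s rP rQ hP hQ)

c-compl-≤ : ∀ {k} (P : Pattern k) s → Respects (inE P) s → components k (restrict (inE P) (compl s)) ℕ.≤ c P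
c-compl-≤ {k} P s r = subst (components k (restrict (inE P) (compl s)) ℕ.≤_) (sym (c≡components P)) (components-restrict-≤ k (inE P) s r)

inE-restricted : ∀ {k} s (A T : Tree k) → keepLeaves (bothIn s) A ≡ tree T →
                 ∀ i → inE (tree T) i ≡ restrict (inE (tree A)) s i
inE-restricted s A T e i = trans (cong (λ P → inE P i) (sym e)) (inE-keepLeaves A s i)

inE-restricted-node : ∀ {k} s (A B TA TB : Tree k) →
                      (∀ i → inE (tree TA) i ≡ restrict (inE (tree A)) s i) →
                      (∀ i → inE (tree TB) i ≡ restrict (inE (tree B)) s i) →
                      ∀ i → inE ⟪ TA , TB ⟫ i ≡ restrict (inE ⟪ A , B ⟫) s i
inE-restricted-node s A B TA TB hA hB i = begin
  inE ⟪ TA , TB ⟫ i ≡⟨ inE-node TA TB i ⟩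
  inE (tree TA) i ∨ inE (tree TB) i ≡⟨ cong₂ _∨_ (hA i) (hB i) ⟩
  restrict (inE (tree A)) s i ∨ restrict (inE (tree B)) s i
    ≡⟨ sym (BP.∧-distribʳ-∨ _ (inE (tree A) i) (inE (tree B) i)) ⟩
  (inE (tree A) i ∨ inE (tree B) i) ∧ (s i ∧ s (suc i)) ≡⟨ cong (_∧ (s i ∧ s (suc i))) (sym (inE-node A B i)) ⟩
  restrict (inE ⟪ A , B ⟫) s i ∎
  where open ≡-Reasoning

keep-⊖ : ∀ {k} s (A' B' A'' B'' : Tree k) → keepLeaves (bothIn s) A' ≡ tree A'' → keepLeaves (bothIn s) B' ≡ tree B'' →
         Respects (inE (tree A')) s → Respects (inE (tree B')) s →
         keep (bothIn s) (tree B' ⊖ tree A') ≡ tree B'' ⊖ tree A''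
keep-⊖ s A' B' A'' B'' eA' eB' rA' rB' = begin
  keep (bothIn s) (tree B' ⊖ tree A') ≡⟨ cong (keep (bothIn s)) (⊖-keep (tree B') (tree A')) ⟩
  keep (bothIn s) (keepLeaves (bothIn T₁) B') ≡⟨ keep-keepLeaves B' (bothIn T₁) (bothIn s) ⟩
  keepLeaves (λ e → bothIn T₁ e ∧ bothIn s e) B' ≡⟨ keepLeaves-ext B' _ _ same-labels ⟩
  keepLeaves (λ e → bothIn s e ∧ bothIn T₂ e) B' ≡⟨ sym (keep-keepLeaves B' (bothIn s) (bothIn T₂)) ⟩
  keep (bothIn T₂) (keepLeaves (bothIn s) B') ≡⟨ cong (keep (bothIn T₂)) eB' ⟩
  keep (bothIn T₂) (tree B'') ≡⟨ sym (⊖-keep (tree B'') (tree A'')) ⟩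
  tree B'' ⊖ tree A'' ∎
  where
  open ≡-Reasoning
  T₁ = detached (tree B') (tree A')
  T₂ = detached (tree B'') (tree A'')
  hB = inE-restricted s B' B'' eB'
  same-labels : ∀ e → inE (tree B') (toℕ e) ≡ true → bothIn T₁ e ∧ bothIn s e ≡ bothIn s e ∧ bothIn T₂ e
  same-labels e h = begin
    bothIn T₁ e ∧ bothIn s e ≡⟨ cong (_∧ bothIn s e) (sym (trans (inE-⊖ (tree B') (tree A') i) (∧-trueˡ _ h))) ⟩
    restrict (inE (tree B' ⊖ tree A')) s i
      ≡⟨ sym (⊖-restrict (tree B') (tree A') (tree B'') (tree A'') s rB' rA' hB (inE-restricted s A' A'' eA') i) ⟩
    inE (tree B'' ⊖ tree A'') i ≡⟨ inE-⊖ (tree B'') (tree A'') i ⟩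
    inE (tree B'') i ∧ bothIn T₂ e ≡⟨ cong (_∧ bothIn T₂ e) (trans (hB i) (∧-trueˡ _ h)) ⟩
    bothIn s e ∧ bothIn T₂ e ∎
    where i = toℕ e

count-combine : ∀ y₁ u₁ Y y₂ u₂ W x z → y₁ ℕ.+ u₁ ℕ.≤ Y → y₂ ℕ.+ u₂ ℕ.≤ W → z ℕ.≤ x ℕ.+ (u₁ ℕ.+ u₂) →
                (y₁ ℕ.+ y₂) ℕ.+ z ℕ.≤ (x ℕ.+ Y) ℕ.+ W
count-combine y₁ u₁ Y y₂ u₂ W x z h₁ h₂ h₃ = begin
  (y₁ ℕ.+ y₂) ℕ.+ z ≤⟨ ℕP.+-monoʳ-≤ (y₁ ℕ.+ y₂) h₃ ⟩
  (y₁ ℕ.+ y₂) ℕ.+ (x ℕ.+ (u₁ ℕ.+ u₂)) ≡⟨ ℕP.+-comm (y₁ ℕ.+ y₂) _ ⟩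
  (x ℕ.+ (u₁ ℕ.+ u₂)) ℕ.+ (y₁ ℕ.+ y₂) ≡⟨ ℕP.+-assoc x (u₁ ℕ.+ u₂) (y₁ ℕ.+ y₂) ⟩
  x ℕ.+ ((u₁ ℕ.+ u₂) ℕ.+ (y₁ ℕ.+ y₂)) ≡⟨ cong (x ℕ.+_) (interchange u₁ u₂ y₁ y₂) ⟩
  x ℕ.+ ((u₁ ℕ.+ y₁) ℕ.+ (u₂ ℕ.+ y₂)) ≡⟨ cong (x ℕ.+_) (cong₂ ℕ._+_ (ℕP.+-comm u₁ y₁) (ℕP.+-comm u₂ y₂)) ⟩
  x ℕ.+ ((y₁ ℕ.+ u₁) ℕ.+ (y₂ ℕ.+ u₂)) ≤⟨ ℕP.+-monoʳ-≤ x (ℕP.+-mono-≤ h₁ h₂) ⟩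
  x ℕ.+ (Y ℕ.+ W) ≡⟨ sym (ℕP.+-assoc x Y W) ⟩
  (x ℕ.+ Y) ℕ.+ W ∎
  where open ℕP.≤-Reasoning

sumBelow-zero : ∀ n (a : ℕ → ℕ) → (∀ v → v ℕ.< n → a v ≡ 0) → sumBelow n a ≡ 0
sumBelow-zero zero a h = refl
sumBelow-zero (suc n) a h rewrite h n ℕP.≤-refl = sumBelow-zero n a (λ v l → h v (ℕP.m≤n⇒m≤1+n l))

sumBelow-single : ∀ n (p : ℕ → Bool) w → (∀ v → p v ≡ true → v ≡ w) → sumBelow n (λ v → bit (p v)) ℕ.≤ 1
sumBelow-single zero p w only = z≤n
sumBelow-single (suc n) p w only with bool-cases (p n)
... | inj₁ f rewrite f = sumBelow-single n p w only
... | inj₂ t = subst (ℕ._≤ 1) (cong₂ ℕ._+_ (cong bit (sym t)) (sym (sumBelow-zero n _ below))) ℕP.≤-refl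
  where
  below : ∀ v → v ℕ.< n → bit (p v) ≡ 0
  below v v<n = cong bit (false-unless λ pv → ℕP.<-irrefl (trans (only v pv) (sym (only n t))) v<n)

c-∅ : ∀ {k} → c (∅ {k}) ≡ 0
c-∅ {k} = trans (c≡components (∅ {k})) (sumBelow-zero (suc k) (λ v → bit (starts (inE (∅ {k})) v)) λ { zero _ → refl ; (suc v) _ → refl })

c-leaf : ∀ {k} (e : Fin k) → c (tree (leaf e)) ℕ.≤ 1
c-leaf {k} e = subst (ℕ._≤ 1) (sym (c≡components (tree (leaf e))))
  (sumBelow-single (suc k) _ (toℕ e) λ v h →
    sym (≡ᵇ-true (toℕ e) v (trans (sym (BP.∨-identityʳ _)) (proj₂ (∧-elim {not (before _ v)} h)))))

module Induction {k : ℕ} (Φ : Pattern k → ℚ) (isΦ : IsΦ Φ) where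

  constraintsΦ : ∀ A B A' B' → A' ⪯ A → B' ⪯ B → Constraints Φ A B A' B' (Φ ⟪ A , B ⟫)
  constraintsΦ = proj₂ (proj₂ (proj₁ isΦ))

  Claim : ℕ → Set
  Claim n = ∀ (P : Pattern k) s → sizeP P ℕ.≤ n → Respects (inE P) s →
            Φ (keep (bothIn s) P) + cℚ (keep (bothIn (compl s)) P) ≤ Φ P

  module Step (n : ℕ) (IH : Claim n) (s : ℕ → Bool) where

    runsᶜ : EdgeSet → ℕ
    runsᶜ E = components k (restrict E (compl s))

    ih : ∀ P → sizeP P ℕ.≤ n → Respects (inE P) s → Φ (keep (bothIn s) P) + N (runsᶜ (inE P)) ≤ Φ P
    ih P sz r = subst (λ t → Φ (keep (bothIn s) P) + t ≤ Φ P) (cong N (c-restrict P (compl s))) (IH P s sz r)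

    -- If B vanishes on S, then C ↾ S = A ↾ S, and (†) with A' = A suffices.
    one-sided : ∀ (A B : Tree k) (C Q : Pattern k) → (∀ i → inE C i ≡ inE (tree A) i ∨ inE (tree B) i) →
                (∀ i → inE Q i ≡ inE (tree A) i ∨ inE (tree B) i) → Respects (inE C) s → size A ℕ.≤ n →
                Φ (tree A) + cℚ (tree B ⊖ tree A) + cℚ (C ⊖ Q) ≤ Φ C →
                Φ (keepLeaves (bothIn s) A) + N (runsᶜ (inE C)) ≤ Φ C
    one-sided A B C Q hC hQ rC szA dagger =
      assemble†₀ (Φ (keepLeaves (bothIn s) A)) (Φ (tree A)) (Φ C) x (c (tree B ⊖ tree A)) (c (C ⊖ Q)) (runsᶜ (inE C))
        (ih (tree A) szA (respects-⊆ _ _ s A⊆C rC)) dagger counts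
      where
      A⊆C : inE (tree A) ⊆ᴱ inE C
      A⊆C i h = trans (hC i) (∨-introˡ _ h)
      B⊆C : inE (tree B) ⊆ᴱ inE C
      B⊆C i h = trans (hC i) (∨-introʳ (inE (tree A) i) h)
      x = runsᶜ (inE (tree A))
      counts : runsᶜ (inE C) ℕ.≤ (x ℕ.+ c (tree B ⊖ tree A)) ℕ.+ c (C ⊖ Q)
      counts = ℕP.≤-trans (compl-cover C (tree A) (tree B) Q s rC A⊆C B⊆C hQ)
        (ℕP.≤-trans (ℕP.+-monoʳ-≤ x (ℕP.+-mono-≤
                      (c-compl-≤ (tree B ⊖ tree A) s (respects-⊆ _ _ s (λ i h → B⊆C i (⊖-⊆ (tree B) (tree A) i h)) rC))
                      (c-compl-≤ (C ⊖ Q) s (respects-⊆ _ _ s (⊖-⊆ C Q) rC))))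
                    (ℕP.≤-reflexive (sym (ℕP.+-assoc x _ _))))

    -- If both sides survive, C ↾ S = X = {TA , TB}.  Every sub-pattern of TA
    -- (of TB) is the restriction of a sub-pattern of A (of B), so each
    -- inequality at X follows from the corresponding one at C, the induction
    -- hypothesis and the counting lemmas, with M = Φ C - c(C ↾ S̄) as bound.
    module BothSides (A B TA TB : Tree k) (C X : Pattern k)
                     (hC : ∀ i → inE C i ≡ inE (tree A) i ∨ inE (tree B) i)
                     (hX : ∀ i → inE X i ≡ restrict (inE C) s i) (rC : Respects (inE C) s)
                     (szA : size A ℕ.≤ n) (szB : size B ℕ.≤ n)
                     (eA : keepLeaves (bothIn s) A ≡ tree TA) (eB : keepLeaves (bothIn s) B ≡ tree TB) where

      M : ℚ
      M = Φ C - N (runsᶜ (inE C))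

      A⊆C : inE (tree A) ⊆ᴱ inE C
      A⊆C i h = trans (hC i) (∨-introˡ _ h)
      B⊆C : inE (tree B) ⊆ᴱ inE C
      B⊆C i h = trans (hC i) (∨-introʳ (inE (tree A) i) h)

      ih-sub : ∀ A' A'' → A' ⪯ A → keepLeaves (bothIn s) A' ≡ tree A'' →
               Φ (tree A'') + N (runsᶜ (inE (tree A'))) ≤ Φ (tree A')
      ih-sub A' A'' pA' eA' = subst (λ P → Φ P + N (runsᶜ (inE (tree A'))) ≤ Φ (tree A')) eA'
        (ih (tree A') (ℕP.≤-trans (size-⪯ pA') szA) (respects-⊆ (inE (tree A')) (inE C) s (λ i h → A⊆C i (inE-⪯ pA' i h)) rC))

      dagger-lifted : ∀ A' A'' → A' ⪯ A → keepLeaves (bothIn s) A' ≡ tree A'' →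
                      Φ (tree A') + cℚ (tree B ⊖ tree A') + cℚ (C ⊖ ⟪ A' , B ⟫) ≤ Φ C →
                      Φ (tree A'') + cℚ (tree TB ⊖ tree A'') + cℚ (X ⊖ ⟪ A'' , TB ⟫) ≤ M
      dagger-lifted A' A'' pA' eA' atC =
        move (Φ (tree A'') + cℚ (tree TB ⊖ tree A'') + cℚ (X ⊖ ⟪ A'' , TB ⟫)) (N z) (Φ C)
          (assemble† (Φ (tree A'')) (Φ (tree A')) (Φ C) x (c (tree B ⊖ tree A')) (c (C ⊖ ⟪ A' , B ⟫))
                     (c (tree TB ⊖ tree A'')) (c (X ⊖ ⟪ A'' , TB ⟫)) z (ih-sub A' A'' pA' eA') atC counts)
        where
        A'⊆C : inE (tree A') ⊆ᴱ inE C
        A'⊆C i h = A⊆C i (inE-⪯ pA' i h)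
        x = runsᶜ (inE (tree A'))
        z = runsᶜ (inE C)
        hA'' = inE-restricted s A' A'' eA'
        hTB = inE-restricted s B TB eB
        counts : (c (tree TB ⊖ tree A'') ℕ.+ c (X ⊖ ⟪ A'' , TB ⟫)) ℕ.+ z
                 ℕ.≤ (x ℕ.+ c (tree B ⊖ tree A')) ℕ.+ c (C ⊖ ⟪ A' , B ⟫)
        counts = count-combine (c (tree TB ⊖ tree A'')) (runsᶜ (inE (tree B ⊖ tree A'))) (c (tree B ⊖ tree A'))
                               (c (X ⊖ ⟪ A'' , TB ⟫)) (runsᶜ (inE (C ⊖ ⟪ A' , B ⟫))) (c (C ⊖ ⟪ A' , B ⟫)) x z
          (c-⊖-split (tree B) (tree A') (tree TB) (tree A'') s
            (respects-⊆ (inE (tree B)) (inE C) s B⊆C rC) (respects-⊆ (inE (tree A')) (inE C) s A'⊆C rC) hTB hA'')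
          (c-⊖-split C ⟪ A' , B ⟫ X ⟪ A'' , TB ⟫ s rC
            (respects-⊆ (inE ⟪ A' , B ⟫) (inE C) s (inE-node-⊆ A' B C A'⊆C B⊆C) rC) hX
            (inE-restricted-node s A' B A'' TB hA'' hTB))
          (compl-cover C (tree A') (tree B) ⟪ A' , B ⟫ s rC A'⊆C B⊆C (inE-node A' B))

      ddagger-lifted : ∀ A' A'' B' B'' → A' ⪯ A → keepLeaves (bothIn s) A' ≡ tree A'' →
                       B' ⪯ B → keepLeaves (bothIn s) B' ≡ tree B'' →
                       ½ * (Φ (tree A') + Φ (tree B' ⊖ tree A') + cℚ C + cℚ (C ⊖ ⟪ A' , B' ⟫)) ≤ Φ C →
                       ½ * (Φ (tree A'') + Φ (tree B'' ⊖ tree A'') + cℚ X + cℚ (X ⊖ ⟪ A'' , B'' ⟫)) ≤ M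
      ddagger-lifted A' A'' B' B'' pA' eA' pB' eB' atC =
        move (½ * (Φ (tree A'') + Φ (tree B'' ⊖ tree A'') + cℚ X + cℚ (X ⊖ ⟪ A'' , B'' ⟫))) (N z) (Φ C)
          (assemble‡ (Φ (tree A'')) (Φ (tree B'' ⊖ tree A'')) (Φ (tree A')) (Φ (tree B' ⊖ tree A')) (Φ C)
                     x y (c X) z (c C) (c (X ⊖ ⟪ A'' , B'' ⟫)) w (c (C ⊖ ⟪ A' , B' ⟫))
            (ih-sub A' A'' pA' eA') ih-⊖ atC (c-split C X s rC hX)
            (c-⊖-split C ⟪ A' , B' ⟫ X ⟪ A'' , B'' ⟫ s rC
              (respects-⊆ (inE ⟪ A' , B' ⟫) (inE C) s (inE-node-⊆ A' B' C A'⊆C B'⊆C) rC) hX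
              (inE-restricted-node s A' B' A'' B'' hA'' hB''))
            (compl-cover C (tree A') (tree B') ⟪ A' , B' ⟫ s rC A'⊆C B'⊆C (inE-node A' B')))
        where
        A'⊆C : inE (tree A') ⊆ᴱ inE C
        A'⊆C i h = A⊆C i (inE-⪯ pA' i h)
        B'⊆C : inE (tree B') ⊆ᴱ inE C
        B'⊆C i h = B⊆C i (inE-⪯ pB' i h)
        hA'' = inE-restricted s A' A'' eA'
        hB'' = inE-restricted s B' B'' eB'
        x = runsᶜ (inE (tree A'))
        y = runsᶜ (inE (tree B' ⊖ tree A'))
        z = runsᶜ (inE C)
        w = runsᶜ (inE (C ⊖ ⟪ A' , B' ⟫))
        ih-⊖ : Φ (tree B'' ⊖ tree A'') + N y ≤ Φ (tree B' ⊖ tree A')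
        ih-⊖ = subst (λ P → Φ P + N y ≤ Φ (tree B' ⊖ tree A'))
                 (keep-⊖ s A' B' A'' B'' eA' eB' (respects-⊆ (inE (tree A')) (inE C) s A'⊆C rC)
                                                 (respects-⊆ (inE (tree B')) (inE C) s B'⊆C rC))
                 (ih (tree B' ⊖ tree A') (ℕP.≤-trans (size-⊖ B' (tree A')) (ℕP.≤-trans (size-⪯ pB') szB))
                     (respects-⊆ (inE (tree B' ⊖ tree A')) (inE C) s (λ i h → B'⊆C i (⊖-⊆ (tree B') (tree A') i h)) rC))

      dagger : (∀ A' → A' ⪯ A → Φ (tree A') + cℚ (tree B ⊖ tree A') + cℚ (C ⊖ ⟪ A' , B ⟫) ≤ Φ C) →
               ∀ A'' → A'' ⪯ TA → Φ (tree A'') + cℚ (tree TB ⊖ tree A'') + cℚ (X ⊖ ⟪ A'' , TB ⟫) ≤ M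
      dagger atC A'' pA'' =
        let (A' , pA' , eA') = keepLeaves-⪯ (bothIn s) A TA eA A'' pA''
        in dagger-lifted A' A'' pA' eA' (atC A' pA')

      ddagger : (∀ A' B' → A' ⪯ A → B' ⪯ B →
                   ½ * (Φ (tree A') + Φ (tree B' ⊖ tree A') + cℚ C + cℚ (C ⊖ ⟪ A' , B' ⟫)) ≤ Φ C) →
                ∀ A'' B'' → A'' ⪯ TA → B'' ⪯ TB →
                ½ * (Φ (tree A'') + Φ (tree B'' ⊖ tree A'') + cℚ X + cℚ (X ⊖ ⟪ A'' , B'' ⟫)) ≤ M
      ddagger atC A'' B'' pA'' pB'' =
        let (A' , pA' , eA') = keepLeaves-⪯ (bothIn s) A TA eA A'' pA''
            (B' , pB' , eB') = keepLeaves-⪯ (bothIn s) B TB eB B'' pB''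
        in ddagger-lifted A' A'' B' B'' pA' eA' pB' eB' (atC A' B' pA' pB')

    swapped : ∀ (A B : Tree k) i → inE ⟪ A , B ⟫ i ≡ inE (tree B) i ∨ inE (tree A) i
    swapped A B i = trans (inE-node A B i) (BP.∨-comm (inE (tree A) i) (inE (tree B) i))

    node-step : ∀ (A B : Tree k) → size A ℕ.≤ n → size B ℕ.≤ n → Respects (inE ⟪ A , B ⟫) s →
                ∀ X Y → keepLeaves (bothIn s) A ≡ X → keepLeaves (bothIn s) B ≡ Y →
                Φ (pair X Y) + N (runsᶜ (inE ⟪ A , B ⟫)) ≤ Φ ⟪ A , B ⟫
    node-step A B szA szB r ∅ Y eA eB =
      subst (λ P → Φ P + N (runsᶜ (inE ⟪ A , B ⟫)) ≤ Φ ⟪ A , B ⟫) eB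
        (one-sided B A ⟪ A , B ⟫ ⟪ B , A ⟫ (swapped A B) (inE-node B A) r szB
          (proj₁ (proj₂ (proj₂ (constraintsΦ A B A B here here)))))
    node-step A B szA szB r (tree TA) ∅ eA eB =
      subst (λ P → Φ P + N (runsᶜ (inE ⟪ A , B ⟫)) ≤ Φ ⟪ A , B ⟫) eA
        (one-sided A B ⟪ A , B ⟫ ⟪ A , B ⟫ (inE-node A B) (inE-node A B) r szA
          (proj₁ (constraintsΦ A B A B here here)))
    node-step A B szA szB r (tree TA) (tree TB) eA eB =
      move⁻ (Φ ⟪ TA , TB ⟫) (N (runsᶜ (inE ⟪ A , B ⟫))) (Φ ⟪ A , B ⟫) (Lowering.Φ-below Φ isΦ TA TB AB.M bounds)
      where
      hX = inE-restricted-node s A B TA TB (inE-restricted s A TA eA) (inE-restricted s B TB eB)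
      module AB = BothSides A B TA TB ⟪ A , B ⟫ ⟪ TA , TB ⟫ (inE-node A B) hX r szA szB eA eB
      module BA = BothSides B A TB TA ⟪ A , B ⟫ ⟪ TA , TB ⟫ (swapped A B) hX r szB szA eB eA
      bounds : ∀ A'' B'' → A'' ⪯ TA → B'' ⪯ TB → Constraints Φ TA TB A'' B'' AB.M
      bounds A'' B'' pA pB =
        AB.dagger (λ A' p → proj₁ (constraintsΦ A B A' B p here)) A'' pA ,
        AB.ddagger (λ A' B' p p' → proj₁ (proj₂ (constraintsΦ A B A' B' p p'))) A'' B'' pA pB ,
        BA.dagger (λ B' p → proj₁ (proj₂ (proj₂ (constraintsΦ A B A B' here p)))) B'' pB ,
        BA.ddagger (λ B' A' p p' → proj₂ (proj₂ (proj₂ (constraintsΦ A B A' B' p' p)))) B'' A'' pB pA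

  nothing-removed : ∀ P → Φ P + cℚ (∅ {k}) ≤ Φ P
  nothing-removed P = ℚP.≤-reflexive (trans (cong (λ m → Φ P + N m) (c-∅ {k})) (ℚP.+-identityʳ (Φ P)))

  -- An edge on the far side of S is one component: Φ(edge) = 2 ≥ Φ(∅) + 1.
  removed-edge : ∀ e → Φ ∅ + cℚ (tree (leaf e)) ≤ Φ (tree (leaf e))
  removed-edge e = subst₂ (λ a b → a + cℚ (tree (leaf e)) ≤ b) (sym (proj₁ (proj₁ isΦ))) (sym (proj₁ (proj₂ (proj₁ isΦ)) e))
    (ℚP.≤-trans (ℚP.≤-reflexive (ℚP.+-identityˡ _)) (N-mono {c (tree (leaf e))} {2} (ℕP.≤-trans (c-leaf e) (s≤s z≤n))))

  -- A single edge lies entirely on one side of S.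
  leaf-case : ∀ e s → Respects (inE (tree (leaf e))) s →
              Φ (keepLeaves (bothIn s) (leaf e)) + cℚ (keepLeaves (bothIn (compl s)) (leaf e)) ≤ Φ (tree (leaf e))
  leaf-case e s r = by-sides (s (toℕ e)) (s (suc (toℕ e))) refl refl (r (toℕ e) (inE-leaf e))
    where
    kept : ∀ p b → bothIn p e ≡ b → keepLeaves (bothIn p) (leaf e) ≡ (if b then tree (leaf e) else ∅)
    kept p b h = cong (λ x → if x then tree (leaf e) else ∅) h
    by-sides : ∀ a b → s (toℕ e) ≡ a → s (suc (toℕ e)) ≡ b → a ≡ b →
               Φ (keepLeaves (bothIn s) (leaf e)) + cℚ (keepLeaves (bothIn (compl s)) (leaf e)) ≤ Φ (tree (leaf e))
    by-sides true true ea eb _ = subst₂ (λ X Y → Φ X + cℚ Y ≤ Φ (tree (leaf e)))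
      (sym (kept s true (cong₂ _∧_ ea eb))) (sym (kept (compl s) false (cong₂ (λ x y → not x ∧ not y) ea eb)))
      (nothing-removed (tree (leaf e)))
    by-sides false false ea eb _ = subst₂ (λ X Y → Φ X + cℚ Y ≤ Φ (tree (leaf e)))
      (sym (kept s false (cong₂ _∧_ ea eb))) (sym (kept (compl s) true (cong₂ (λ x y → not x ∧ not y) ea eb)))
      (removed-edge e)
    by-sides true false _ _ ()
    by-sides false true _ _ ()

  claim : ∀ n → Claim n
  claim n ∅ s _ _ = nothing-removed ∅
  claim n (tree (leaf e)) s _ r = leaf-case e s r
  claim zero (tree (node A B)) s sz _ = ⊥-elim (ℕP.1+n≰n (ℕP.≤-trans (size-pos (node A B)) sz))
  claim (suc n) (tree (node A B)) s sz r =
    subst (λ t → Φ (pair (keepLeaves (bothIn s) A) (keepLeaves (bothIn s) B)) + t ≤ Φ ⟪ A , B ⟫)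
      (sym (cong N (c-restrict ⟪ A , B ⟫ (compl s))))
      (Step.node-step n (claim n) s A B szA szB r (keepLeaves (bothIn s) A) (keepLeaves (bothIn s) B) refl refl)
    where
    szA : size A ℕ.≤ n
    szA = ℕP.≤-pred (subst (ℕ._≤ suc n) (ℕP.+-comm (size A) 1) (ℕP.≤-trans (ℕP.+-monoʳ-≤ (size A) (size-pos B)) sz))
    szB : size B ℕ.≤ n
    szB = ℕP.≤-pred (ℕP.≤-trans (ℕP.+-monoˡ-≤ (size B) (size-pos A)) sz)

-- Membership in a subset, read as a predicate on positions (false beyond).
member : ∀ {n} → Vec Bool n → ℕ → Bool
member [] v = false
member (b ∷ bs) zero = b
member (b ∷ bs) (suc v) = member bs v

lookup-member : ∀ {n} (S : Vec Bool n) i → lookup S i ≡ member S (toℕ i)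
lookup-member (b ∷ S) fzero = refl
lookup-member (b ∷ S) (fsuc i) = lookup-member S i

↾-by-predicate : ∀ {k} (P : Pattern k) (S : Subset (suc k)) p → (∀ i → lookup S i ≡ p (toℕ i)) →
                 P ↾ S ≡ keep (bothIn p) P
↾-by-predicate P S p h = trans (↾-keep P S) (keep-ext P _ _ λ e →
  cong₂ _∧_ (trans (h (inject₁ e)) (cong p (FP.toℕ-inject₁ e))) (h (fsuc e)))

label-witness : ∀ {k} {Q : Fin k → Set} (l : List (Fin k)) i → All Q l → any (λ e → toℕ e ≡ᵇ i) l ≡ true →
                Σ (Fin k) λ e → Q e × toℕ e ≡ i
label-witness (e ∷ l) i (qe ∷ qs) h with ∨-elim {toℕ e ≡ᵇ i} h
... | inj₁ x = e , qe , ≡ᵇ-true _ _ x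
... | inj₂ x = label-witness l i qs x

respecting⇒respects : ∀ {k} (P : Pattern k) S → Respecting P S → Respects (inE P) (member S)
respecting⇒respects P S resp i h with label-witness (labels P) i resp h
... | e , inj₁ (a , b) , refl = trans (cong (member S) (sym (FP.toℕ-inject₁ e))) (trans (inside a) (sym (inside b)))
  where
  inside : ∀ {j} → j ∈ S → member S (toℕ j) ≡ true
  inside {j} h = trans (sym (lookup-member S j)) (VP.[]=⇒lookup h)
... | e , inj₂ (a , b) , refl = trans (cong (member S) (sym (FP.toℕ-inject₁ e))) (trans (outside a) (sym (outside b)))
  where
  outside : ∀ {j} → j ∉ S → member S (toℕ j) ≡ false
  outside {j} h = false-unless λ t → h (VP.lookup⇒[]= j S (trans (lookup-member S j) t))

lemma11p3 : ∀ (k : ℕ) (Φ : Pattern k → ℚ) → IsΦ Φ →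
    ∀ (A : Pattern k) (S : Subset (suc k)) → Respecting A S →
    Φ (A ↾ S) + cℚ (A ↾ ∁ S) ≤ Φ A
lemma11p3 k Φ isΦ A S resp =
  subst₂ (λ X Y → Φ X + cℚ Y ≤ Φ A)
    (sym (↾-by-predicate A S (member S) (lookup-member S)))
    (sym (↾-by-predicate A (∁ S) (compl (member S)) (λ i → trans (VP.lookup-map i not S) (cong not (lookup-member S i)))))
    (Induction.claim Φ isΦ (sizeP A) A (member S) ℕP.≤-refl (respecting⇒respects A S resp))
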